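{- The proof system $\mathsf{H}^0\mathsf{L}\mathsf{S}$ is sound and complete for $\mathrm{PTL}$: for every set $\Phi$ of $\mathrm{PTL}$ formulas and every $\mathrm{PTL}$ formula $\varphi$, $\Phi\vdash\varphi$ in $\mathsf{H}^0\mathsf{L}\mathsf{S}$ if and only if $\Phi\models\varphi$.
   Context: Fix a countably infinite set $\mathrm{PS}$ of propositional variables. $\mathrm{PL}$ formulas are built from $\mathrm{PS}$ with $\neg,\to$ (with $\top,\bot,\lor,\land$ as usual abbreviations). $\mathrm{PTL}$ formulas: closure of $\mathrm{PL}$ under $\sim$ (strong negation), $\rightarrowtail$ (material implication) and $\multimap$ (linear implication). Abbreviations: $\varphi\otimes\psi:=\sim(\varphi\multimap\sim\psi)$, $\varphi\sqcap\psi:=\sim(\varphi\rightarrowtail\sim\psi)$, $\varphi\bowtie\psi:=(\varphi\rightarrowtail\psi)\sqcap(\psi\rightarrowtail\varphi)$. $\alpha,\beta,\gamma$ denote $\mathrm{PL}$ formulas; $\varphi,\psi,\vartheta$ arbitrary formulas. Semantics: a team $T$ is a (possibly empty) set of assignments $s:\mathrm{PS}\to\{0,1\}$. For $\alpha\in\mathrm{PL}$, $T\models\alpha$ iff every $s\in T$ satisfies $\alpha$ classically; $T\models\sim\varphi$ iff $T\not\models\varphi$; $T\models\varphi\rightarrowtail\psi$ iff $T\not\models\varphi$ or $T\models\psi$; $T\models\varphi\multimap\psi$ iff for all $S,U$ with $S\cup U=T$, $S\models\varphi$ implies $U\models\psi$. $\Phi\models\varphi$ means every team satisfying all formulas of $\Phi$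 satisfies $\varphi$. Derivations: $\Phi\vdash\varphi$ means there is a finite sequence ending in $\varphi$ each member of which is in $\Phi$, an axiom instance, or obtained from earlier members by a rule; "theorem only" rules may be applied only to formulas derivable without premises. $\mathsf{H}^0\mathsf{L}\mathsf{S}$: ($\mathsf{H}^0$, classical formulas) $\alpha\to(\beta\to\alpha)$; $(\alpha\to(\beta\to\gamma))\to((\alpha\to\beta)\to(\alpha\to\gamma))$; $(\neg\alpha\to\neg\beta)\to(\beta\to\alpha)$; from $\alpha,\alpha\to\beta$ infer $\beta$. ($\mathsf{L}$) $\varphi\rightarrowtail(\psi\rightarrowtail\varphi)$; $(\varphi\rightarrowtail(\psi\rightarrowtail\vartheta))\rightarrowtail((\varphi\rightarrowtail\psi)\rightarrowtail(\varphi\rightarrowtail\vartheta))$; $(\sim\varphi\rightarrowtail\sim\psi)\rightarrowtail(\psi\rightarrowtail\varphi)$; $(\alpha\to\beta)\rightarrowtail(\alpha\rightarrowtail\beta)$; from $\varphi,\varphi\rightarrowtail\psi$ infer $\psi$. ($\mathsf{S}$) $(\alpha\otimes\beta)\bowtie(\alpha\lor\beta)$; $\alpha\rightarrowtail(\varphi\multimap\alpha)$; $\varphi\rightarrowtail((\varphi\multimap\psi)\rightarrowtail(\vartheta\multimap\psi))$; $(\varphi\multimap(\psi\multimap\vartheta))\rightarrowtail(\psi\multimap(\varphi\multimap\vartheta))$; $(\varphi\multimap\sim\psi)\rightarrowtail(\psi\multimap\sim\varphi)$; $(\varphi\multimap(\psi\rightarrowtail\vartheta))\rightarrowtail((\varphi\multimap\psi)\rightarrowtail(\varphi\multimap\vartheta))$;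 theorem-only rule: from $\varphi$ infer $\psi\multimap\varphi$. -}

module Defs where

open import Data.Nat using (ℕ)
open import Data.Bool using (Bool; true; false; not; _∨_)
open import Data.Product using (_×_)
open import Data.Sum using (_⊎_)
open import Relation.Nullary using (¬_)
open import Level using (Lift; suc; zero)
open import Data.Empty using (⊥)
open import Relation.Binary.PropositionalEquality using (_≡_)

data PL : Set where
  var  : ℕ → PL
  neg  : PL → PL
  _⇒_  : PL → PL → PL

infixr 5 _⇒_

_∨ᶜ_ : PL → PL → PL
α ∨ᶜ β = neg α ⇒ β

-- PTL formulas: closure of PL under ~, ↣ (material) and ⊸ (linear).
data Fml : Set where
  pl   : PL → Fml
  ∼_   : Fml → Fml
  _↣_  : Fml → Fml → Fml
  _⊸_  : Fml → Fml → Fml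

infix  7 ∼_
infixr 4 _↣_
infixr 4 _⊸_

_⊗_ : Fml → Fml → Fml
φ ⊗ ψ = ∼ (φ ⊸ ∼ ψ)

_⊓_ : Fml → Fml → Fml
φ ⊓ ψ = ∼ (φ ↣ ∼ ψ)

_⋈_ : Fml → Fml → Fml
φ ⋈ ψ = (φ ↣ ψ) ⊓ (ψ ↣ φ)

Assignment : Set
Assignment = ℕ → Bool

evalPL : Assignment → PL → Bool
evalPL s (var p) = s p
evalPL s (neg α) = not (evalPL s α)
evalPL s (α ⇒ β) = not (evalPL s α) ∨ evalPL s β

-- A team is a (possibly empty) set of assignments, as a predicate.
Team : Set₁
Team = Assignment → Set

IsUnion : Team → Team → Team → Set
IsUnion T S U = (s : Assignment) → (T s → S s ⊎ U s) × (S s ⊎ U s → T s)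

_⊨_ : Team → Fml → Set₁
T ⊨ pl α    = Lift (suc zero) ((s : Assignment) → T s → evalPL s α ≡ true)
T ⊨ (∼ φ)   = ¬ (T ⊨ φ)
T ⊨ (φ ↣ ψ) = ¬ (T ⊨ φ) ⊎ (T ⊨ ψ)
T ⊨ (φ ⊸ ψ) = (S U : Team) → IsUnion T S U → S ⊨ φ → U ⊨ ψ

FmlSet : Set₁
FmlSet = Fml → Set

∅ : FmlSet
∅ _ = ⊥

_⊫_ : FmlSet → Fml → Set₁
Φ ⊫ φ = (T : Team) → ((ψ : Fml) → Φ ψ → T ⊨ ψ) → T ⊨ φ

data _⊢_ : FmlSet → Fml → Set₁ where
  hyp : ∀ {Φ φ} → Φ φ → Φ ⊢ φ
  H1  : ∀ {Φ} α β → Φ ⊢ pl (α ⇒ (β ⇒ α))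
  H2  : ∀ {Φ} α β γ → Φ ⊢ pl ((α ⇒ (β ⇒ γ)) ⇒ ((α ⇒ β) ⇒ (α ⇒ γ)))
  H3  : ∀ {Φ} α β → Φ ⊢ pl ((neg α ⇒ neg β) ⇒ (β ⇒ α))
  MP⁰ : ∀ {Φ α β} → Φ ⊢ pl α → Φ ⊢ pl (α ⇒ β) → Φ ⊢ pl β
  L1  : ∀ {Φ} φ ψ → Φ ⊢ (φ ↣ (ψ ↣ φ))
  L2  : ∀ {Φ} φ ψ ϑ → Φ ⊢ ((φ ↣ (ψ ↣ ϑ)) ↣ ((φ ↣ ψ) ↣ (φ ↣ ϑ)))
  L3  : ∀ {Φ} φ ψ → Φ ⊢ ((∼ φ ↣ ∼ ψ) ↣ (ψ ↣ φ))
  L4  : ∀ {Φ} α β → Φ ⊢ (pl (α ⇒ β) ↣ (pl α ↣ pl β))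
  MP  : ∀ {Φ φ ψ} → Φ ⊢ φ → Φ ⊢ (φ ↣ ψ) → Φ ⊢ ψ
  S1  : ∀ {Φ} α β → Φ ⊢ ((pl α ⊗ pl β) ⋈ pl (α ∨ᶜ β))
  S2  : ∀ {Φ} α φ → Φ ⊢ (pl α ↣ (φ ⊸ pl α))
  S3  : ∀ {Φ} φ ψ ϑ → Φ ⊢ (φ ↣ ((φ ⊸ ψ) ↣ (ϑ ⊸ ψ)))
  S4  : ∀ {Φ} φ ψ ϑ → Φ ⊢ ((φ ⊸ (ψ ⊸ ϑ)) ↣ (ψ ⊸ (φ ⊸ ϑ)))
  S5  : ∀ {Φ} φ ψ → Φ ⊢ ((φ ⊸ ∼ ψ) ↣ (ψ ⊸ ∼ φ))
  S6  : ∀ {Φ} φ ψ ϑ → Φ ⊢ ((φ ⊸ (ψ ↣ ϑ)) ↣ ((φ ⊸ ψ) ↣ (φ ⊸ ϑ)))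
  -- theorem-only rule: from ⊢ φ (no premises) infer ψ ⊸ φ
  Nec : ∀ {Φ φ} ψ → ∅ ⊢ φ → Φ ⊢ (ψ ⊸ φ)

-- Completeness goes through
-- characteristic formulas.  The projection of a team T onto the variables
-- p₀,…,p_{m-1} is a set X ⊆ Bool^m (coded as a decision tree `VSet m`), and
-- X has a characteristic formula χ m ⊤P X with three properties:
--   (i)   every team projecting to X satisfies it;
--   (ii)  (truth lemma) if φ only mentions variables below m, it proves φ
--         or ∼φ, according as the teams projecting to X satisfy φ or not;
--   (iii) the characteristic formulas of all X ⊆ Bool^m are provably
--         exhaustive.
-- If Φ ⊬ φ, then by (iii) the consistent set Φ ∪ {∼φ} can be extended by
-- one characteristic formula of some Xₘ for each m.  Consistency and (ii)
-- force the Xₘ to cohere, so they are the projections of a single team T*,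
-- which by (ii) satisfies Φ and ∼φ, contradicting Φ ⊫ φ.
module Submission where

open import Defs
open import Axiom.ExcludedMiddle using (ExcludedMiddle)
open import Level using (lift)
open import Function using (Equivalence)
open import Data.Empty using (⊥; ⊥-elim)
open import Data.Bool using (Bool; true; false; not; _∨_; _∧_; T; if_then_else_) renaming (_≟_ to _≟ᵇ_)
open import Data.Bool.Properties using (T-≡; T-∧)
open import Data.Nat using (ℕ; zero; suc; _≤_; _<_; _⊔_; _+_; _∸_; _≟_; _≤?_; _<?_; z≤n; s≤s)
open import Data.Nat.Properties
  using (≤-refl; <-≤-trans; <⇒≤; m≤m⊔n; m≤n⊔m; m≤n⇒m≤1+n; ≤∧≢⇒<; <-irrefl; m+n∸n≡m; m≤n+m; +-comm; ≤⇒≯)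
open import Data.Fin using (Fin; zero; suc; toℕ; fromℕ<)
open import Data.Fin.Properties using (toℕ-fromℕ<)
open import Data.Vec using (Vec; []; _∷_; lookup; tabulate; map)
open import Data.Vec.Properties using (lookup∘tabulate; lookup-map; ∷-injective)
open import Data.List using (List; []; _∷_)
open import Data.List.Membership.Propositional using (_∈_)
open import Data.List.Relation.Unary.Any using (here; there)
open import Data.Product using (Σ; ∃; _×_; _,_; proj₁; proj₂)
open import Data.Product.Properties using (≡-dec)
open import Data.Sum using (_⊎_; inj₁; inj₂; [_,_]′; swap)
open import Relation.Nullary using (¬_; yes; no)
open import Relation.Binary.Definitions using (DecidableEquality)
open import Relation.Binary.PropositionalEquality
  using (_≡_; _≢_; refl; sym; trans; cong; cong₂; subst)

data Schema (n : ℕ) : Set where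
  at  : Fin n → Schema n
  ~_  : Schema n → Schema n
  _⇛_ : Schema n → Schema n → Schema n

infixr 5 _⇛_
infix 7 ~_

evalSchema : ∀ {n} → Vec Bool n → Schema n → Bool
evalSchema v (at i) = lookup v i
evalSchema v (~ S) = not (evalSchema v S)
evalSchema v (S ⇛ R) = not (evalSchema v S) ∨ evalSchema v R

-- A Boolean test of a property at all 2ⁿ valuations; for closed schemata
-- it computes, so tautology side conditions below are discharged by `refl`.
forAll : (n : ℕ) → (Vec Bool n → Bool) → Bool
forAll zero f = f []
forAll (suc n) f = forAll n (λ w → f (true ∷ w)) ∧ forAll n (λ w → f (false ∷ w))

forAll-sound : (n : ℕ) (f : Vec Bool n → Bool) → T (forAll n f) → (v : Vec Bool n) → f v ≡ true
forAll-sound zero f h [] = Equivalence.to T-≡ h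
forAll-sound (suc n) f h (true ∷ v) = forAll-sound n _ (proj₁ (Equivalence.to T-∧ h)) v
forAll-sound (suc n) f h (false ∷ v) = forAll-sound n _ (proj₂ (Equivalence.to T-∧ h)) v

IsTautology : ∀ {n} → Schema n → Set
IsTautology {n} S = T (forAll n (λ v → evalSchema v S))

-- Any Hilbert calculus with the three classical axiom schemes and modus
-- ponens derives every instance of every tautology (Kalmár's argument).
module Kalmar {F : Set} (_⇒_ : F → F → F) (¬h : F → F) where
  data Der (Γ : List F) : F → Set where
    hyp : ∀ {φ} → φ ∈ Γ → Der Γ φ
    ax1 : ∀ φ ψ → Der Γ (φ ⇒ (ψ ⇒ φ))
    ax2 : ∀ φ ψ θ → Der Γ ((φ ⇒ (ψ ⇒ θ)) ⇒ ((φ ⇒ ψ) ⇒ (φ ⇒ θ)))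
    ax3 : ∀ φ ψ → Der Γ ((¬h φ ⇒ ¬h ψ) ⇒ (ψ ⇒ φ))
    mp  : ∀ {φ ψ} → Der Γ φ → Der Γ (φ ⇒ ψ) → Der Γ ψ

  identity : ∀ {Γ} φ → Der Γ (φ ⇒ φ)
  identity φ = mp (ax1 φ φ) (mp (ax1 φ (φ ⇒ φ)) (ax2 φ (φ ⇒ φ) φ))

  deduction : ∀ {Γ φ ψ} → Der (φ ∷ Γ) ψ → Der Γ (φ ⇒ ψ)
  deduction {φ = φ} (hyp (here refl)) = identity φ
  deduction {φ = φ} (hyp (there x)) = mp (hyp x) (ax1 _ φ)
  deduction {φ = φ} (ax1 a b) = mp (ax1 a b) (ax1 _ φ)
  deduction {φ = φ} (ax2 a b c) = mp (ax2 a b c) (ax1 _ φ)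
  deduction {φ = φ} (ax3 a b) = mp (ax3 a b) (ax1 _ φ)
  deduction {φ = φ} (mp d e) = mp (deduction d) (mp (deduction e) (ax2 φ _ _))

  weaken : ∀ {Γ φ ψ} → Der Γ φ → Der (ψ ∷ Γ) φ
  weaken (hyp x) = hyp (there x)
  weaken (ax1 a b) = ax1 a b
  weaken (ax2 a b c) = ax2 a b c
  weaken (ax3 a b) = ax3 a b
  weaken (mp d e) = mp (weaken d) (weaken e)

  hyp₀ : ∀ {Γ φ} → Der (φ ∷ Γ) φ
  hyp₀ = hyp (here refl)

  hyp₁ : ∀ {Γ φ ψ} → Der (ψ ∷ φ ∷ Γ) φ
  hyp₁ = hyp (there (here refl))

  explosion : ∀ {Γ} a b → Der Γ (¬h a ⇒ (a ⇒ b))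
  explosion a b = deduction (deduction (mp hyp₀ (mp (mp hyp₁ (ax1 (¬h a) (¬h b))) (ax3 b a))))

  ¬¬-elim : ∀ {Γ} a → Der Γ (¬h (¬h a) ⇒ a)
  ¬¬-elim a = deduction (mp hyp₀ (mp (mp hyp₀ (explosion (¬h a) (¬h (¬h (¬h a))))) (ax3 a (¬h (¬h a)))))

  ¬¬-intro : ∀ {Γ} a → Der Γ (a ⇒ ¬h (¬h a))
  ¬¬-intro a = mp (¬¬-elim (¬h a)) (ax3 (¬h (¬h a)) a)

  contraposition : ∀ {Γ a b} → Der Γ (a ⇒ b) → Der Γ (¬h b ⇒ ¬h a)
  contraposition {a = a} {b} d =
    mp (deduction (mp (mp (mp hyp₀ (¬¬-elim a)) (weaken d)) (¬¬-intro b))) (ax3 (¬h a) (¬h b))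

  false-implication : ∀ {Γ} a b → Der Γ (a ⇒ (¬h b ⇒ ¬h (a ⇒ b)))
  false-implication a b = deduction (contraposition (deduction (mp hyp₁ hyp₀)))

  by-cases : ∀ {Γ} a b → Der Γ ((a ⇒ b) ⇒ ((¬h a ⇒ b) ⇒ b))
  by-cases {Γ} a b = deduction (deduction (mp (ax1 a a) (mp (deduction both-fail) (ax3 b C))))
    where
      C = a ⇒ (a ⇒ a)
      both-fail : Der (¬h b ∷ (¬h a ⇒ b) ∷ (a ⇒ b) ∷ Γ) (¬h C)
      both-fail = mp (mp hyp₀ (contraposition (hyp (there (there (here refl))))))
                     (mp (mp hyp₀ (contraposition (hyp (there (here refl))))) (explosion (¬h a) (¬h C)))

  signed : Bool → F → F
  signed true φ = φ
  signed false φ = ¬h φ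

  instantiate : ∀ {n} → Vec F n → Schema n → F
  instantiate σ (at i) = lookup σ i
  instantiate σ (~ S) = ¬h (instantiate σ S)
  instantiate σ (S ⇛ R) = instantiate σ S ⇒ instantiate σ R

  context : ∀ {n} → Vec F n → Vec Bool n → List F
  context [] [] = []
  context (φ ∷ σ) (b ∷ v) = signed b φ ∷ context σ v

  context-∋ : ∀ {n} (σ : Vec F n) v i → signed (lookup v i) (lookup σ i) ∈ context σ v
  context-∋ (φ ∷ σ) (b ∷ v) zero = here refl
  context-∋ (φ ∷ σ) (b ∷ v) (suc i) = there (context-∋ σ v i)

  kalmar : ∀ {n} (σ : Vec F n) v (S : Schema n) → Der (context σ v) (signed (evalSchema v S) (instantiate σ S))
  kalmar σ v (at i) = hyp (context-∋ σ v i)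
  kalmar σ v (~ S) with evalSchema v S | kalmar σ v S
  ... | true | d = mp d (¬¬-intro _)
  ... | false | d = d
  kalmar σ v (S ⇛ R) with evalSchema v S | kalmar σ v S | evalSchema v R | kalmar σ v R
  ... | false | d | _ | _ = mp d (explosion _ _)
  ... | true | d | true | e = mp e (ax1 _ _)
  ... | true | d | false | e = mp e (mp d (false-implication _ _))

  discharge : ∀ {n} (σ : Vec F n) G → (∀ v → Der (context σ v) G) → Der [] G
  discharge [] G h = h []
  discharge (φ ∷ σ) G h =
    discharge σ G (λ w → mp (deduction (h (false ∷ w))) (mp (deduction (h (true ∷ w))) (by-cases φ G)))

  tautology : ∀ {n} (σ : Vec F n) (S : Schema n) → (∀ v → evalSchema v S ≡ true) → Der [] (instantiate σ S)
  tautology σ S h =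
    discharge σ _ (λ v → subst (λ b → Der (context σ v) (signed b (instantiate σ S))) (h v) (kalmar σ v S))

  checked-tautology : ∀ {n} (σ : Vec F n) (S : Schema n) → IsTautology S → Der [] (instantiate σ S)
  checked-tautology {n} σ S h = tautology σ S (forAll-sound n (λ v → evalSchema v S) h)

-- The two classical fragments of H⁰LS: material connectives over all
-- formulas (axioms L1–L3) and Boolean connectives over PL (axioms H1–H3).
module Material = Kalmar _↣_ ∼_
module Boolean = Kalmar _⇒_ neg

x0 : ∀ {n} → Schema (suc n)
x0 = at zero
x1 : ∀ {n} → Schema (suc (suc n))
x1 = at (suc zero)
x2 : ∀ {n} → Schema (suc (suc (suc n)))
x2 = at (suc (suc zero))
x3 : ∀ {n} → Schema (suc (suc (suc (suc n))))
x3 = at (suc (suc (suc zero)))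
x4 : ∀ {n} → Schema (suc (suc (suc (suc (suc n)))))
x4 = at (suc (suc (suc (suc zero))))
x5 : ∀ {n} → Schema (suc (suc (suc (suc (suc (suc n))))))
x5 = at (suc (suc (suc (suc (suc zero)))))

_∧ₛ_ : ∀ {n} → Schema n → Schema n → Schema n
a ∧ₛ b = ~ (a ⇛ ~ b)

_∨ₛ_ : ∀ {n} → Schema n → Schema n → Schema n
a ∨ₛ b = ~ a ⇛ b

infixr 6 _∧ₛ_
infixr 6 _∨ₛ_

fromMaterial : ∀ {Φ φ} → Material.Der [] φ → Φ ⊢ φ
fromMaterial (Material.hyp ())
fromMaterial (Material.ax1 a b) = L1 a b
fromMaterial (Material.ax2 a b c) = L2 a b c
fromMaterial (Material.ax3 a b) = L3 a b
fromMaterial (Material.mp d e) = MP (fromMaterial d) (fromMaterial e)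

fromBoolean : ∀ {Φ α} → Boolean.Der [] α → Φ ⊢ pl α
fromBoolean (Boolean.hyp ())
fromBoolean (Boolean.ax1 a b) = H1 a b
fromBoolean (Boolean.ax2 a b c) = H2 a b c
fromBoolean (Boolean.ax3 a b) = H3 a b
fromBoolean (Boolean.mp d e) = MP⁰ (fromBoolean d) (fromBoolean e)

-- Instances of tautologies with ∼, ↣ (over any formulas) and with neg, ⇒
-- (over PL formulas); the tautology check runs at type-checking time.
tautL : ∀ {n} (S : Schema n) (σ : Vec Fml n) {h : IsTautology S} {Φ} → Φ ⊢ Material.instantiate σ S
tautL S σ {h} = fromMaterial (Material.checked-tautology σ S h)

tautPL : ∀ {n} (S : Schema n) (σ : Vec PL n) {h : IsTautology S} {Φ} → Φ ⊢ pl (Boolean.instantiate σ S)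
tautPL S σ {h} = fromBoolean (Boolean.checked-tautology σ S h)

_,,_ : FmlSet → Fml → FmlSet
(Φ ,, A) χ = Φ χ ⊎ χ ≡ A

monotone⊢ : ∀ {Φ Ψ φ} → (∀ ψ → Φ ψ → Ψ ψ) → Φ ⊢ φ → Ψ ⊢ φ
monotone⊢ f (hyp x) = hyp (f _ x)
monotone⊢ f (H1 α β) = H1 α β
monotone⊢ f (H2 α β γ) = H2 α β γ
monotone⊢ f (H3 α β) = H3 α β
monotone⊢ f (MP⁰ d e) = MP⁰ (monotone⊢ f d) (monotone⊢ f e)
monotone⊢ f (L1 φ ψ) = L1 φ ψ
monotone⊢ f (L2 φ ψ ϑ) = L2 φ ψ ϑ
monotone⊢ f (L3 φ ψ) = L3 φ ψ
monotone⊢ f (L4 α β) = L4 α β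
monotone⊢ f (MP d e) = MP (monotone⊢ f d) (monotone⊢ f e)
monotone⊢ f (S1 α β) = S1 α β
monotone⊢ f (S2 α φ) = S2 α φ
monotone⊢ f (S3 φ ψ ϑ) = S3 φ ψ ϑ
monotone⊢ f (S4 φ ψ ϑ) = S4 φ ψ ϑ
monotone⊢ f (S5 φ ψ) = S5 φ ψ
monotone⊢ f (S6 φ ψ ϑ) = S6 φ ψ ϑ
monotone⊢ f (Nec ψ d) = Nec ψ d

theorem⊢ : ∀ {Φ φ} → ∅ ⊢ φ → Φ ⊢ φ
theorem⊢ = monotone⊢ (λ _ ())

const↣ : ∀ {Φ A B} → Φ ⊢ B → Φ ⊢ (A ↣ B)
const↣ {A = A} {B} d = MP d (L1 B A)

-- The deduction theorem for ↣; the theorem-only rule Nec is what makes it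
-- go through (its premise never depends on the discharged assumption).
deduction-theorem : ∀ {Φ A B} → (Φ ,, A) ⊢ B → Φ ⊢ (A ↣ B)
deduction-theorem (hyp (inj₁ x)) = const↣ (hyp x)
deduction-theorem {A = A} (hyp (inj₂ refl)) = tautL (x0 ⇛ x0) (A ∷ [])
deduction-theorem (H1 α β) = const↣ (H1 α β)
deduction-theorem (H2 α β γ) = const↣ (H2 α β γ)
deduction-theorem (H3 α β) = const↣ (H3 α β)
deduction-theorem {A = A} (MP⁰ {α = α} {β} d e) =
  MP (deduction-theorem d)
     (MP (MP (deduction-theorem e) (MP (const↣ (L4 α β)) (L2 A _ _))) (L2 A (pl α) (pl β)))
deduction-theorem (L1 φ ψ) = const↣ (L1 φ ψ)
deduction-theorem (L2 φ ψ ϑ) = const↣ (L2 φ ψ ϑ)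
deduction-theorem (L3 φ ψ) = const↣ (L3 φ ψ)
deduction-theorem (L4 α β) = const↣ (L4 α β)
deduction-theorem {A = A} (MP d e) = MP (deduction-theorem d) (MP (deduction-theorem e) (L2 A _ _))
deduction-theorem (S1 α β) = const↣ (S1 α β)
deduction-theorem (S2 α φ) = const↣ (S2 α φ)
deduction-theorem (S3 φ ψ ϑ) = const↣ (S3 φ ψ ϑ)
deduction-theorem (S4 φ ψ ϑ) = const↣ (S4 φ ψ ϑ)
deduction-theorem (S5 φ ψ) = const↣ (S5 φ ψ)
deduction-theorem (S6 φ ψ ϑ) = const↣ (S6 φ ψ ϑ)
deduction-theorem (Nec ψ d) = const↣ (Nec ψ d)

infixr 3 _⟫_
_⟫_ : ∀ {Φ A B C} → Φ ⊢ (A ↣ B) → Φ ⊢ (B ↣ C) → Φ ⊢ (A ↣ C)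
_⟫_ {A = A} {B} {C} d e = MP e (MP d (tautL ((x0 ⇛ x1) ⇛ (x1 ⇛ x2) ⇛ (x0 ⇛ x2)) (A ∷ B ∷ C ∷ [])))

id↣ : ∀ {Φ} A → Φ ⊢ (A ↣ A)
id↣ A = tautL (x0 ⇛ x0) (A ∷ [])

contrap : ∀ {Φ A B} → Φ ⊢ (A ↣ B) → Φ ⊢ (∼ B ↣ ∼ A)
contrap {A = A} {B} d = MP d (tautL ((x0 ⇛ x1) ⇛ (~ x1 ⇛ ~ x0)) (A ∷ B ∷ []))

contrap′ : ∀ {Φ A B} → Φ ⊢ (A ↣ ∼ B) → Φ ⊢ (B ↣ ∼ A)
contrap′ {A = A} {B} d = MP d (tautL ((x0 ⇛ ~ x1) ⇛ (x1 ⇛ ~ x0)) (A ∷ B ∷ []))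

dni : ∀ {Φ} A → Φ ⊢ (A ↣ ∼ ∼ A)
dni A = tautL (x0 ⇛ ~ ~ x0) (A ∷ [])

dne : ∀ {Φ} A → Φ ⊢ (∼ ∼ A ↣ A)
dne A = tautL (~ ~ x0 ⇛ x0) (A ∷ [])

⊓-fst : ∀ {Φ} A B → Φ ⊢ ((A ⊓ B) ↣ A)
⊓-fst A B = tautL ((x0 ∧ₛ x1) ⇛ x0) (A ∷ B ∷ [])

⊓-snd : ∀ {Φ} A B → Φ ⊢ ((A ⊓ B) ↣ B)
⊓-snd A B = tautL ((x0 ∧ₛ x1) ⇛ x1) (A ∷ B ∷ [])

⊓-pair : ∀ {Φ A B C} → Φ ⊢ (A ↣ B) → Φ ⊢ (A ↣ C) → Φ ⊢ (A ↣ (B ⊓ C))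
⊓-pair {A = A} {B} {C} d e = MP e (MP d (tautL ((x0 ⇛ x1) ⇛ (x0 ⇛ x2) ⇛ (x0 ⇛ (x1 ∧ₛ x2))) (A ∷ B ∷ C ∷ [])))

⊓-mono : ∀ {Φ A0 A1 B0 B1} → Φ ⊢ (A0 ↣ B0) → Φ ⊢ (A1 ↣ B1) → Φ ⊢ ((A0 ⊓ A1) ↣ (B0 ⊓ B1))
⊓-mono {A0 = A0} {A1} {B0} {B1} d e = MP e (MP d
  (tautL ((x0 ⇛ x2) ⇛ (x1 ⇛ x3) ⇛ ((x0 ∧ₛ x1) ⇛ (x2 ∧ₛ x3))) (A0 ∷ A1 ∷ B0 ∷ B1 ∷ [])))

curry : ∀ {Φ A B C} → Φ ⊢ ((A ⊓ B) ↣ C) → Φ ⊢ (A ↣ (B ↣ C))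
curry {A = A} {B} {C} d = MP d (tautL (((x0 ∧ₛ x1) ⇛ x2) ⇛ (x0 ⇛ (x1 ⇛ x2))) (A ∷ B ∷ C ∷ []))

uncurry : ∀ {Φ A B C} → Φ ⊢ (A ↣ (B ↣ C)) → Φ ⊢ ((A ⊓ B) ↣ C)
uncurry {A = A} {B} {C} d = MP d (tautL ((x0 ⇛ (x1 ⇛ x2)) ⇛ ((x0 ∧ₛ x1) ⇛ x2)) (A ∷ B ∷ C ∷ []))

flip↣ : ∀ {Φ A B C} → Φ ⊢ (A ↣ (B ↣ C)) → Φ ⊢ (B ↣ (A ↣ C))
flip↣ {A = A} {B} {C} d = MP d (tautL ((x0 ⇛ (x1 ⇛ x2)) ⇛ (x1 ⇛ (x0 ⇛ x2))) (A ∷ B ∷ C ∷ []))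

combine : ∀ {Φ A B C D} → Φ ⊢ (A ↣ B) → Φ ⊢ (A ↣ C) → Φ ⊢ (B ↣ (C ↣ D)) → Φ ⊢ (A ↣ D)
combine {A = A} {B} {C} {D} d1 d2 d3 = MP d3 (MP d2 (MP d1
  (tautL ((x0 ⇛ x1) ⇛ (x0 ⇛ x2) ⇛ (x1 ⇛ (x2 ⇛ x3)) ⇛ (x0 ⇛ x3)) (A ∷ B ∷ C ∷ D ∷ []))))

-- A fixed true PL formula, the absurd formula of PTL, and the PL formula
-- `empty` that holds exactly in the empty team.
⊤P : PL
⊤P = var 0 ⇒ var 0

⊥P : PL
⊥P = neg ⊤P

⊥F : Fml
⊥F = ∼ pl ⊤P

empty : Fml
empty = pl ⊥P

⊤-intro : ∀ {Φ} → Φ ⊢ pl ⊤P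
⊤-intro = tautPL (x0 ⇛ x0) (var 0 ∷ [])

pl-mp : ∀ {Φ α β} → Φ ⊢ pl (α ⇒ β) → Φ ⊢ (pl α ↣ pl β)
pl-mp {α = α} {β} d = MP d (L4 α β)

pl-mp₂ : ∀ {Φ α β γ} → Φ ⊢ pl (α ⇒ (β ⇒ γ)) → Φ ⊢ (pl α ↣ (pl β ↣ pl γ))
pl-mp₂ {α = α} {β} {γ} d = pl-mp d ⟫ L4 β γ

-- A ⊸ _ behaves like a normal box modality: it distributes over theorems.
⊸-map : ∀ {Φ} A {P Q} → ∅ ⊢ (P ↣ Q) → Φ ⊢ ((A ⊸ P) ↣ (A ⊸ Q))
⊸-map A {P} {Q} d = MP (Nec A d) (S6 A P Q)

⊸-map₂ : ∀ {Φ} A {P Q R} → ∅ ⊢ (P ↣ (Q ↣ R)) → Φ ⊢ ((A ⊸ P) ↣ ((A ⊸ Q) ↣ (A ⊸ R)))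
⊸-map₂ A {P} {Q} {R} d = ⊸-map A d ⟫ S6 A Q R

-- _ ⊸ P is antitone, by contraposition through S5.
⊸-antitone : ∀ {Φ A A'} P → ∅ ⊢ (A' ↣ A) → Φ ⊢ ((A ⊸ P) ↣ (A' ⊸ P))
⊸-antitone {A = A} {A'} P d =
  ⊸-map A (dni P) ⟫ S5 A (∼ P) ⟫ ⊸-map (∼ P) (contrap d) ⟫ S5 (∼ P) A' ⟫ ⊸-map A' (dne P)

⊸-vacuous : ∀ {Φ A} ψ → ∅ ⊢ (∼ A) → Φ ⊢ (A ⊸ ψ)
⊸-vacuous {A = A} ψ d = MP (Nec (∼ ψ) d) (S5 (∼ ψ) A ⟫ ⊸-map A (dne ψ))

⊸-cases : ∀ {Φ} C p ψ → Φ ⊢ (((C ⊓ p) ⊸ ψ) ↣ (((C ⊓ (∼ p)) ⊸ ψ) ↣ (C ⊸ ψ)))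
⊸-cases C p ψ =
  MP (transpose (C ⊓ p)) (MP (transpose (C ⊓ (∼ p)))
   (MP (⊸-map₂ (∼ ψ) {∼ (C ⊓ p)} {∼ (C ⊓ (∼ p))} {∼ C}
         (tautL (~ (x0 ∧ₛ x1) ⇛ (~ (x0 ∧ₛ ~ x1) ⇛ ~ x0)) (C ∷ p ∷ [])))
    (MP (S5 (∼ ψ) C ⟫ ⊸-map C (dne ψ))
     (tautL ((x4 ⇛ x5) ⇛ (x0 ⇛ (x1 ⇛ x4)) ⇛ (x3 ⇛ x1) ⇛ (x2 ⇛ x0) ⇛ (x2 ⇛ (x3 ⇛ x5)))
       ((∼ ψ ⊸ ∼ (C ⊓ p)) ∷ (∼ ψ ⊸ ∼ (C ⊓ (∼ p))) ∷ ((C ⊓ p) ⊸ ψ) ∷ ((C ⊓ (∼ p)) ⊸ ψ)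
        ∷ (∼ ψ ⊸ ∼ C) ∷ (C ⊸ ψ) ∷ [])))))
  where
    transpose : ∀ {Φ} A → Φ ⊢ ((A ⊸ ψ) ↣ (∼ ψ ⊸ ∼ A))
    transpose A = ⊸-map A (dni ψ) ⟫ S5 A (∼ ψ)

⊗-mono : ∀ {Φ A A' B B'} → ∅ ⊢ (A ↣ A') → ∅ ⊢ (B ↣ B') → Φ ⊢ ((A ⊗ B) ↣ (A' ⊗ B'))
⊗-mono {A = A} {A'} {B} {B'} d e = contrap (⊸-antitone (∼ B') d ⟫ ⊸-map A (contrap e))

⊗-monoˡ : ∀ {Φ A A'} B → ∅ ⊢ (A ↣ A') → Φ ⊢ ((A ⊗ B) ↣ (A' ⊗ B))
⊗-monoˡ B d = ⊗-mono d (id↣ B)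

⊗-monoʳ : ∀ {Φ B B'} A → ∅ ⊢ (B ↣ B') → Φ ⊢ ((A ⊗ B) ↣ (A ⊗ B'))
⊗-monoʳ A d = ⊗-mono (id↣ A) d

⊗-comm : ∀ {Φ} A B → Φ ⊢ ((A ⊗ B) ↣ (B ⊗ A))
⊗-comm A B = contrap (S5 B A)

⊗-assoc : ∀ {Φ} A B C → Φ ⊢ (((A ⊗ B) ⊗ C) ↣ (A ⊗ (B ⊗ C)))
⊗-assoc A B C =
  contrap (⊸-map A (dne (B ⊸ ∼ C) ⟫ S5 B C) ⟫ S4 A C (∼ B) ⟫ ⊸-map C (dni (A ⊸ ∼ B)) ⟫ S5 C (A ⊗ B))

⊗-assoc⁻ : ∀ {Φ} A B C → Φ ⊢ ((A ⊗ (B ⊗ C)) ↣ ((A ⊗ B) ⊗ C))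
⊗-assoc⁻ A B C = ⊗-comm A (B ⊗ C) ⟫ ⊗-assoc B C A ⟫ ⊗-comm B (C ⊗ A) ⟫ ⊗-assoc C A B ⟫ ⊗-comm C (A ⊗ B)

⊗-medial : ∀ {Φ} A B C D → Φ ⊢ (((A ⊗ B) ⊗ (C ⊗ D)) ↣ ((A ⊗ C) ⊗ (B ⊗ D)))
⊗-medial A B C D =
  ⊗-assoc A B (C ⊗ D) ⟫ ⊗-monoʳ A (⊗-assoc⁻ B C D ⟫ ⊗-monoˡ D (⊗-comm B C) ⟫ ⊗-assoc C B D)
  ⟫ ⊗-assoc⁻ A C (B ⊗ D)

flat-join : ∀ {Φ} α β → Φ ⊢ ((pl α ⊗ pl β) ↣ pl (α ∨ᶜ β))
flat-join α β = MP (S1 α β) (tautL (((x0 ⇛ x1) ∧ₛ (x1 ⇛ x0)) ⇛ (x0 ⇛ x1)) ((pl α ⊗ pl β) ∷ pl (α ∨ᶜ β) ∷ []))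

flat-split : ∀ {Φ} α β → Φ ⊢ (pl (α ∨ᶜ β) ↣ (pl α ⊗ pl β))
flat-split α β = MP (S1 α β) (tautL (((x0 ⇛ x1) ∧ₛ (x1 ⇛ x0)) ⇛ (x1 ⇛ x0)) ((pl α ⊗ pl β) ∷ pl (α ∨ᶜ β) ∷ []))

-- A team splits as itself together with the whole team (which satisfies ⊤).
⊗⊤-intro : ∀ {Φ} A → Φ ⊢ (A ↣ (A ⊗ pl ⊤P))
⊗⊤-intro A = MP ⊤⊗⊤ (MP (S3 A (∼ pl ⊤P) (pl ⊤P))
  (tautL ((x0 ⇛ (x1 ⇛ x2)) ⇛ (~ x2 ⇛ (x0 ⇛ ~ x1))) (A ∷ (A ⊸ ∼ pl ⊤P) ∷ (pl ⊤P ⊸ ∼ pl ⊤P) ∷ [])))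
  where
    ⊤⊗⊤ : ∀ {Φ} → Φ ⊢ (pl ⊤P ⊗ pl ⊤P)
    ⊤⊗⊤ = MP (tautPL (~ (x0 ⇛ x0) ⇛ (x0 ⇛ x0)) (var 0 ∷ [])) (flat-split ⊤P ⊤P)

-- A team satisfying A and B splits as T ∪ T into an A-part and a B-part.
⊗-intro : ∀ {Φ} A B → Φ ⊢ (A ↣ (B ↣ (A ⊗ B)))
⊗-intro A B = MP (⊗⊤-intro A) (MP (S5 (pl ⊤P) A) (MP (S3 B (∼ A) (pl ⊤P)) (MP (S5 A B) glue)))
  where
    glue : ∀ {Φ} → Φ ⊢ _
    glue = tautL ((x5 ⇛ x1) ⇛ (x4 ⇛ (x1 ⇛ x2)) ⇛ (x2 ⇛ x3) ⇛ (x0 ⇛ ~ x3) ⇛ (x0 ⇛ (x4 ⇛ ~ x5)))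
             (A ∷ (B ⊸ ∼ A) ∷ (pl ⊤P ⊸ ∼ A) ∷ (A ⊸ ∼ pl ⊤P) ∷ B ∷ (A ⊸ ∼ B) ∷ [])

-- ∼γ says some member violates γ; such a member lies in every part of a
-- split that is not a γ-part, and it is a violator in any team containing it.
witness-⊸ : ∀ {Φ} γ → Φ ⊢ (∼ pl γ ↣ (pl γ ⊸ ∼ pl γ))
witness-⊸ γ = contrap (flat-join γ γ ⟫ pl-mp (tautPL ((x0 ∨ₛ x0) ⇛ x0) (γ ∷ []))) ⟫ dne _

witness-⊗ : ∀ {Φ} β A → Φ ⊢ (((∼ pl β) ⊗ A) ↣ ∼ pl β)
witness-⊗ β A = contrap (S2 β A ⟫ ⊸-map A (dni (pl β)) ⟫ S5 A (∼ pl β))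

-- E persists across A: whenever a team satisfies E, so does the
-- complementary part U of every split S ∪ U with S ⊨ A.
Persists : Fml → Fml → Set₁
Persists A E = ∅ ⊢ (E ↣ (A ⊸ E))

⊗-carry : ∀ {Φ A E} B → Persists A E → Φ ⊢ (E ↣ ((A ⊗ B) ↣ (A ⊗ (B ⊓ E))))
⊗-carry {A = A} {E} B persists =
  MP (theorem⊢ persists) (MP (⊸-map₂ A {E} {∼ (B ⊓ E)} {∼ B} (tautL (x0 ⇛ (~ (x1 ∧ₛ x0) ⇛ ~ x1)) (E ∷ B ∷ [])))
   (tautL ((x1 ⇛ (x2 ⇛ x3)) ⇛ (x0 ⇛ x1) ⇛ (x0 ⇛ (~ x3 ⇛ ~ x2)))
      (E ∷ (A ⊸ E) ∷ (A ⊸ ∼ (B ⊓ E)) ∷ (A ⊸ ∼ B) ∷ [])))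

persists-⊓ : ∀ {A E1 E2} → Persists A E1 → Persists A E2 → Persists A (E1 ⊓ E2)
persists-⊓ {A} {E1} {E2} p1 p2 =
  MP (⊸-map₂ A {E1} {E2} {E1 ⊓ E2} (tautL (x0 ⇛ (x1 ⇛ (x0 ∧ₛ x1))) (E1 ∷ E2 ∷ [])))
   (MP p2 (MP p1 (tautL ((x0 ⇛ x2) ⇛ (x1 ⇛ x3) ⇛ (x2 ⇛ (x3 ⇛ x4)) ⇛ ((x0 ∧ₛ x1) ⇛ x4))
     (E1 ∷ E2 ∷ (A ⊸ E1) ∷ (A ⊸ E2) ∷ (A ⊸ (E1 ⊓ E2)) ∷ []))))

persists-⊤ : ∀ {A} → Persists A (pl ⊤P)
persists-⊤ {A} = const↣ (Nec A ⊤-intro)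

persists-witness : ∀ {A β γ} → ∅ ⊢ (A ↣ pl β) → ∅ ⊢ (pl β ↣ pl γ) → Persists A (∼ pl γ)
persists-witness {A} {β} {γ} d e = witness-⊸ γ ⟫ ⊸-antitone (∼ pl γ) (d ⟫ e)

BelowPL : ℕ → PL → Set
BelowPL M (var i) = i < M
BelowPL M (neg α) = BelowPL M α
BelowPL M (α ⇒ β) = BelowPL M α × BelowPL M β

belowPL-mono : ∀ {M M'} α → M ≤ M' → BelowPL M α → BelowPL M' α
belowPL-mono (var i) le b = <-≤-trans b le
belowPL-mono (neg α) le b = belowPL-mono α le b
belowPL-mono (α ⇒ β) le (b , c) = belowPL-mono α le b , belowPL-mono β le c

boundPL : PL → ℕ
boundPL (var i) = suc i
boundPL (neg α) = boundPL α
boundPL (α ⇒ β) = boundPL α ⊔ boundPL β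

boundPL-below : ∀ α → BelowPL (boundPL α) α
boundPL-below (var i) = ≤-refl
boundPL-below (neg α) = boundPL-below α
boundPL-below (α ⇒ β) =
  belowPL-mono α (m≤m⊔n _ _) (boundPL-below α) , belowPL-mono β (m≤n⊔m _ _) (boundPL-below β)

agreePL : ∀ {M} α (s t : Assignment) → BelowPL M α → (∀ i → i < M → s i ≡ t i) → evalPL s α ≡ evalPL t α
agreePL (var i) s t b ag = ag i b
agreePL (neg α) s t b ag = cong not (agreePL α s t b ag)
agreePL (α ⇒ β) s t (b , c) ag = cong₂ (λ x y → not x ∨ y) (agreePL α s t b ag) (agreePL β s t c ag)

-- Reading a PL formula with variables ≤ N as a schema over N+1 variables.
finBelow : (N : ℕ) → ℕ → Fin (suc N)
finBelow N i with i ≤? N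
... | yes p = fromℕ< (s≤s p)
... | no _ = zero

finBelow-toℕ : ∀ N i → i < suc N → toℕ (finBelow N i) ≡ i
finBelow-toℕ N i (s≤s i≤N) with i ≤? N
... | yes p = toℕ-fromℕ< (s≤s p)
... | no i≰N = ⊥-elim (i≰N i≤N)

asSchema : (N : ℕ) → PL → Schema (suc N)
asSchema N (var i) = at (finBelow N i)
asSchema N (neg α) = ~ asSchema N α
asSchema N (α ⇒ β) = asSchema N α ⇛ asSchema N β

variables : (N : ℕ) → Vec PL (suc N)
variables N = tabulate (λ j → var (toℕ j))

instantiate-asSchema : ∀ N α → BelowPL (suc N) α → Boolean.instantiate (variables N) (asSchema N α) ≡ α
instantiate-asSchema N (var i) b =
  trans (lookup∘tabulate (λ j → var (toℕ j)) (finBelow N i)) (cong var (finBelow-toℕ N i b))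
instantiate-asSchema N (neg α) b = cong neg (instantiate-asSchema N α b)
instantiate-asSchema N (α ⇒ β) (b , c) = cong₂ _⇒_ (instantiate-asSchema N α b) (instantiate-asSchema N β c)

assignmentOf : (N : ℕ) → Vec Bool (suc N) → Assignment
assignmentOf N v i = lookup v (finBelow N i)

eval-asSchema : ∀ N v α → evalSchema v (asSchema N α) ≡ evalPL (assignmentOf N v) α
eval-asSchema N v (var i) = refl
eval-asSchema N v (neg α) = cong not (eval-asSchema N v α)
eval-asSchema N v (α ⇒ β) = cong₂ (λ x y → not x ∨ y) (eval-asSchema N v α) (eval-asSchema N v β)

pl-valid : ∀ {Φ} α → (∀ s → evalPL s α ≡ true) → Φ ⊢ pl α
pl-valid α h =
  subst (λ x → _ ⊢ pl x) (instantiate-asSchema N α (belowPL-mono α (m≤n⇒m≤1+n ≤-refl) (boundPL-below α)))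
    (fromBoolean (Boolean.tautology (variables N) (asSchema N α)
                   (λ v → trans (eval-asSchema N v α) (h (assignmentOf N v)))))
  where N = boundPL α

pl-entails : ∀ {Φ} α β → (∀ s → evalPL s α ≡ true → evalPL s β ≡ true) → Φ ⊢ (pl α ↣ pl β)
pl-entails α β h = pl-mp (pl-valid (α ⇒ β) λ s → material (evalPL s α) (evalPL s β) (h s))
  where
    material : ∀ a b → (a ≡ true → b ≡ true) → (not a ∨ b) ≡ true
    material false b f = refl
    material true b f = f refl

pl-entails₂ : ∀ {Φ} α β γ → (∀ s → evalPL s α ≡ true → evalPL s β ≡ true → evalPL s γ ≡ true) →
              Φ ⊢ (pl α ↣ (pl β ↣ pl γ))
pl-entails₂ α β γ h = pl-mp₂ (pl-valid (α ⇒ (β ⇒ γ)) λ s → material (evalPL s α) (evalPL s β) (evalPL s γ) (h s))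
  where
    material : ∀ a b c → (a ≡ true → b ≡ true → c ≡ true) → (not a ∨ (not b ∨ c)) ≡ true
    material false b c f = refl
    material true false c f = refl
    material true true c f = f refl refl

bool-mp : ∀ {a b} → a ≡ true → (not a ∨ b) ≡ true → b ≡ true
bool-mp {true} refl q = q

eval-instantiate : ∀ {n} s (σ : Vec PL n) (S : Schema n) →
                   evalPL s (Boolean.instantiate σ S) ≡ evalSchema (map (evalPL s) σ) S
eval-instantiate s σ (at i) = sym (lookup-map i (evalPL s) σ)
eval-instantiate s σ (~ S) = cong not (eval-instantiate s σ S)
eval-instantiate s σ (S ⇛ R) = cong₂ (λ x y → not x ∨ y) (eval-instantiate s σ S) (eval-instantiate s σ R)

instance-valid : ∀ {n} (S : Schema n) (σ : Vec PL n) {h : IsTautology S} s →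
                 evalPL s (Boolean.instantiate σ S) ≡ true
instance-valid {n} S σ {h} s =
  trans (eval-instantiate s σ S) (forAll-sound n (λ v → evalSchema v S) h (map (evalPL s) σ))

false≢true : false ≢ true
false≢true ()

_∪ₜ_ : Team → Team → Team
(S ∪ₜ U) s = S s ⊎ U s

∪ₜ-union : ∀ S U → IsUnion (S ∪ₜ U) S U
∪ₜ-union S U s = (λ x → x) , (λ x → x)

union-sym : ∀ {T S U} → IsUnion T S U → IsUnion T U S
union-sym un s = (λ x → swap (proj₁ (un s) x)) , (λ y → proj₂ (un s) (swap y))

union-⊆ʳ : ∀ {T S U} → IsUnion T S U → ∀ s → U s → T s
union-⊆ʳ un s u = proj₂ (un s) (inj₂ u)

union-absorb : ∀ {T S U} → IsUnion T S U → IsUnion T T U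
union-absorb un s = inj₁ , [ (λ t → t) , union-⊆ʳ un s ]′

union-rotate : ∀ {T A B C D} → IsUnion T A B → IsUnion B C D → IsUnion T C (A ∪ₜ D)
union-rotate un un′ s =
  (λ t → [ (λ a → inj₂ (inj₁ a)) , (λ b → [ inj₁ , (λ d → inj₂ (inj₂ d)) ]′ (proj₁ (un′ s) b)) ]′ (proj₁ (un s) t))
  , [ (λ c → proj₂ (un s) (inj₂ (proj₂ (un′ s) (inj₁ c))))
    , [ (λ a → proj₂ (un s) (inj₁ a)) , (λ d → proj₂ (un s) (inj₂ (proj₂ (un′ s) (inj₂ d)))) ]′ ]′

_↾_≔_ : Team → (Assignment → Bool) → Bool → Team
(T ↾ f ≔ b) s = T s × f s ≡ b

↾-split : ∀ T f → IsUnion T (T ↾ f ≔ false) (T ↾ f ≔ true)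
↾-split T f s = cover , [ proj₁ , proj₁ ]′
  where
    cover : T s → (T ↾ f ≔ false) s ⊎ (T ↾ f ≔ true) s
    cover t with f s
    ... | false = inj₁ (t , refl)
    ... | true = inj₂ (t , refl)

-- With excluded middle, ∼ and ↣ are classical negation and implication.
module Semantics (lem : ∀ {ℓ} → ExcludedMiddle ℓ) where

  ⊨-stable : ∀ {T φ} → ¬ ¬ (T ⊨ φ) → T ⊨ φ
  ⊨-stable {T} {φ} h with lem {P = T ⊨ φ}
  ... | yes p = p
  ... | no np = ⊥-elim (h np)

  ⊨↣-intro : ∀ {T} φ ψ → (T ⊨ φ → T ⊨ ψ) → T ⊨ (φ ↣ ψ)
  ⊨↣-intro {T} φ ψ f with lem {P = T ⊨ φ}
  ... | yes p = inj₂ (f p)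
  ... | no np = inj₁ np

  ⊨↣-elim : ∀ {T φ ψ} → T ⊨ (φ ↣ ψ) → T ⊨ φ → T ⊨ ψ
  ⊨↣-elim (inj₁ n) p = ⊥-elim (n p)
  ⊨↣-elim (inj₂ q) p = q

  ⊨⊓-intro : ∀ {T φ ψ} → T ⊨ φ → T ⊨ ψ → T ⊨ (φ ⊓ ψ)
  ⊨⊓-intro p q (inj₁ n) = n p
  ⊨⊓-intro p q (inj₂ n) = n q

  ⊨-pl : ∀ {T} α → (∀ s → evalPL s α ≡ true) → T ⊨ pl α
  ⊨-pl α h = lift (λ s _ → h s)

  ⊗-flat : ∀ T α β → T ⊨ (pl α ⊗ pl β) → T ⊨ pl (α ∨ᶜ β)
  ⊗-flat T α β some-split = lift λ s t → member s t (evalPL s α) refl (evalPL s β) refl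
    where
      -- a member violating α and β would lie in the α-part or the β-part
      member : ∀ s → T s → ∀ a → evalPL s α ≡ a → ∀ b → evalPL s β ≡ b → evalPL s (α ∨ᶜ β) ≡ true
      member s t true ea _ _ rewrite ea = refl
      member s t false ea true eb rewrite ea | eb = refl
      member s t false ea false eb = ⊥-elim (some-split λ S U un (lift Sα) (lift Uβ) →
        [ (λ x → false≢true (trans (sym ea) (Sα s x))) , (λ x → false≢true (trans (sym eb) (Uβ s x))) ]′
          (proj₁ (un s) t))

  flat-⊗ : ∀ T α β → T ⊨ pl (α ∨ᶜ β) → T ⊨ (pl α ⊗ pl β)
  flat-⊗ T α β (lift αβ) no-split =
    no-split (T ↾ evalα ≔ true) (T ↾ evalα ≔ false) (union-sym (↾-split T evalα))
      (lift λ s x → proj₂ x)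
      (lift λ s x → right (proj₂ x) (αβ s (proj₁ x)))
    where
      evalα : Assignment → Bool
      evalα s = evalPL s α
      right : ∀ {a b} → a ≡ false → (not (not a) ∨ b) ≡ true → b ≡ true
      right refl q = q

  sound : ∀ {Φ φ} → Φ ⊢ φ → Φ ⊫ φ
  sound (hyp x) T h = h _ x
  sound (H1 α β) T h = ⊨-pl (α ⇒ (β ⇒ α)) (instance-valid (x0 ⇛ x1 ⇛ x0) (α ∷ β ∷ []))
  sound (H2 α β γ) T h = ⊨-pl ((α ⇒ (β ⇒ γ)) ⇒ ((α ⇒ β) ⇒ (α ⇒ γ)))
    (instance-valid ((x0 ⇛ x1 ⇛ x2) ⇛ (x0 ⇛ x1) ⇛ x0 ⇛ x2) (α ∷ β ∷ γ ∷ []))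
  sound (H3 α β) T h = ⊨-pl ((neg α ⇒ neg β) ⇒ (β ⇒ α)) (instance-valid ((~ x0 ⇛ ~ x1) ⇛ x1 ⇛ x0) (α ∷ β ∷ []))
  sound (MP⁰ d e) T h with sound d T h | sound e T h
  ... | lift f | lift g = lift λ s x → bool-mp (f s x) (g s x)
  sound (L1 φ ψ) T h = ⊨↣-intro φ (ψ ↣ φ) λ p → ⊨↣-intro ψ φ λ _ → p
  sound (L2 φ ψ ϑ) T h =
    ⊨↣-intro (φ ↣ (ψ ↣ ϑ)) ((φ ↣ ψ) ↣ (φ ↣ ϑ)) λ f → ⊨↣-intro (φ ↣ ψ) (φ ↣ ϑ) λ g → ⊨↣-intro φ ϑ λ p →
      ⊨↣-elim {ψ = ϑ} (⊨↣-elim {ψ = ψ ↣ ϑ} f p) (⊨↣-elim {ψ = ψ} g p)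
  sound (L3 φ ψ) T h =
    ⊨↣-intro (∼ φ ↣ ∼ ψ) (ψ ↣ φ) λ f → ⊨↣-intro ψ φ λ q → ⊨-stable (λ np → ⊨↣-elim {φ = ∼ φ} {∼ ψ} f np q)
  sound (L4 α β) T h =
    ⊨↣-intro (pl (α ⇒ β)) (pl α ↣ pl β) λ { (lift f) → ⊨↣-intro (pl α) (pl β) λ { (lift g) →
      lift λ s x → bool-mp (g s x) (f s x) } }
  sound (S1 α β) T h =
    ⊨⊓-intro {φ = pl α ⊗ pl β ↣ pl (α ∨ᶜ β)} {pl (α ∨ᶜ β) ↣ pl α ⊗ pl β}
      (⊨↣-intro (pl α ⊗ pl β) (pl (α ∨ᶜ β)) (⊗-flat T α β))
      (⊨↣-intro (pl (α ∨ᶜ β)) (pl α ⊗ pl β) (flat-⊗ T α β))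
  sound (S2 α φ) T h =
    ⊨↣-intro (pl α) (φ ⊸ pl α) λ { (lift f) S U un _ → lift λ s x → f s (union-⊆ʳ un s x) }
  sound (S3 φ ψ ϑ) T h =
    ⊨↣-intro φ ((φ ⊸ ψ) ↣ (ϑ ⊸ ψ)) λ p → ⊨↣-intro (φ ⊸ ψ) (ϑ ⊸ ψ) λ g S U un _ → g T U (union-absorb un) p
  sound (S4 φ ψ ϑ) T h = ⊨↣-intro (φ ⊸ (ψ ⊸ ϑ)) (ψ ⊸ (φ ⊸ ϑ)) λ g S' U un ψS' S U' un′ φS →
    g S (S' ∪ₜ U') (union-rotate un un′) φS S' U' (∪ₜ-union S' U') ψS'
  sound (S5 φ ψ) T h = ⊨↣-intro (φ ⊸ ∼ ψ) (ψ ⊸ ∼ φ) λ g S U un ψS φU → g U S (union-sym un) φU ψS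
  sound (S6 φ ψ ϑ) T h =
    ⊨↣-intro (φ ⊸ (ψ ↣ ϑ)) ((φ ⊸ ψ) ↣ (φ ⊸ ϑ)) λ f → ⊨↣-intro (φ ⊸ ψ) (φ ⊸ ϑ) λ g S U un p →
      ⊨↣-elim {ψ = ϑ} (f S U un p) (g S U un p)
  sound (MP {ψ = ψ} d e) T h = ⊨↣-elim {ψ = ψ} (sound e T h) (sound d T h)
  sound (Nec ψ d) T h = λ S U un _ → sound d U (λ _ ())

  valid : ∀ {φ} → ∅ ⊢ φ → ∀ T → T ⊨ φ
  valid d T = sound d T (λ _ ())

-- A set of valuations of p₀,…,p_{m-1}, coded as a complete binary tree of
-- depth m with Boolean leaves; the root branches on p_{m-1}.
VSet : ℕ → Set
VSet zero = Bool
VSet (suc m) = VSet m × VSet m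

contains : ∀ {m} → VSet m → Vec Bool m → Bool
contains {zero} b [] = b
contains {suc m} (X₀ , X₁) (false ∷ p) = contains X₀ p
contains {suc m} (X₀ , X₁) (true ∷ p) = contains X₁ p

_∪ᵛ_ : ∀ {m} → VSet m → VSet m → VSet m
_∪ᵛ_ {zero} a b = a ∨ b
_∪ᵛ_ {suc m} (Y₀ , Y₁) (Z₀ , Z₁) = (Y₀ ∪ᵛ Z₀) , (Y₁ ∪ᵛ Z₁)

contains-∪ᵛ : ∀ {m} (Y Z : VSet m) p → contains (Y ∪ᵛ Z) p ≡ (contains Y p ∨ contains Z p)
contains-∪ᵛ {zero} Y Z [] = refl
contains-∪ᵛ {suc m} (Y₀ , Y₁) (Z₀ , Z₁) (false ∷ p) = contains-∪ᵛ Y₀ Z₀ p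
contains-∪ᵛ {suc m} (Y₀ , Y₁) (Z₀ , Z₁) (true ∷ p) = contains-∪ᵛ Y₁ Z₁ p

vset-ext : ∀ {m} (X W : VSet m) → (∀ p → contains X p ≡ contains W p) → X ≡ W
vset-ext {zero} X W h = h []
vset-ext {suc m} (X₀ , X₁) (W₀ , W₁) h =
  cong₂ _,_ (vset-ext X₀ W₀ (λ p → h (false ∷ p))) (vset-ext X₁ W₁ (λ p → h (true ∷ p)))

_≟ᵛ_ : ∀ {m} → DecidableEquality (VSet m)
_≟ᵛ_ {zero} = _≟ᵇ_
_≟ᵛ_ {suc m} = ≡-dec _≟ᵛ_ _≟ᵛ_

vset-differ : ∀ {m} (X W : VSet m) → X ≢ W → ∃ λ p → contains X p ≢ contains W p
vset-differ {zero} X W ne = [] , ne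
vset-differ {suc m} (X₀ , X₁) (W₀ , W₁) ne with X₀ ≟ᵛ W₀
... | no ne₀ = let (p , d) = vset-differ X₀ W₀ ne₀ in false ∷ p , d
... | yes refl = let (p , d) = vset-differ X₁ W₁ (λ e → ne (cong (X₀ ,_) e)) in true ∷ p , d

-- The valuation of p₀,…,p_{m-1} under s, most significant variable first.
valuation : Assignment → (m : ℕ) → Vec Bool m
valuation s zero = []
valuation s (suc m) = s m ∷ valuation s m

_∧ᴾ_ : PL → PL → PL
a ∧ᴾ b = neg (a ⇒ neg b)

literal : Bool → ℕ → PL
literal true m = var m
literal false m = neg (var m)

describe : (m : ℕ) → PL → Vec Bool m → PL
describe zero δ [] = δ
describe (suc m) δ (b ∷ p) = describe m (δ ∧ᴾ literal b m) p

-- The characteristic formula χ m δ X: the members satisfy δ, and their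
-- valuations of p₀,…,p_{m-1} form exactly X.  At a leaf the team is either
-- nonempty and inside δ, or empty; a node splits the team by p_{m-1}.
inhabited : PL → Fml
inhabited δ = pl δ ⊓ (∼ pl (neg δ))

χ : (m : ℕ) → PL → VSet m → Fml
χ zero δ true = inhabited δ
χ zero δ false = empty
χ (suc m) δ (X₀ , X₁) = χ m (δ ∧ᴾ literal false m) X₀ ⊗ χ m (δ ∧ᴾ literal true m) X₁

-- The flat part of χ: every member lies in δ and has its valuation in X.
support : (m : ℕ) → PL → VSet m → PL
support zero δ true = δ
support zero δ false = ⊥P
support (suc m) δ (X₀ , X₁) = support m (δ ∧ᴾ literal false m) X₀ ∨ᶜ support m (δ ∧ᴾ literal true m) X₁

-- The existential part of χ: every valuation in X is realised by a member.
occupied : (m : ℕ) → PL → VSet m → Fml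
occupied zero δ true = ∼ pl (neg δ)
occupied zero δ false = pl ⊤P
occupied (suc m) δ (X₀ , X₁) = occupied m (δ ∧ᴾ literal false m) X₀ ⊓ occupied m (δ ∧ᴾ literal true m) X₁

-- Every valuation outside X is absent from the team (a PL formula).
absent : (m : ℕ) → PL → VSet m → PL
absent zero δ true = ⊤P
absent zero δ false = neg δ
absent (suc m) δ (X₀ , X₁) = absent m (δ ∧ᴾ literal false m) X₀ ∧ᴾ absent m (δ ∧ᴾ literal true m) X₁

-- Leaf by leaf, whether the valuation is realised (∼¬) or not (¬): the
-- conjunction of these "literals" is what case distinction produces.
leafwise : (m : ℕ) → PL → VSet m → Fml
leafwise zero δ true = ∼ pl (neg δ)
leafwise zero δ false = pl (neg δ)
leafwise (suc m) δ (X₀ , X₁) = leafwise m (δ ∧ᴾ literal false m) X₀ ⊓ leafwise m (δ ∧ᴾ literal true m) X₁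

∧-true : ∀ {a b} → (a ∧ b) ≡ true → a ≡ true × b ≡ true
∧-true {true} {true} _ = refl , refl

eval-∧ᴾ : ∀ s a b → evalPL s (a ∧ᴾ b) ≡ (evalPL s a ∧ evalPL s b)
eval-∧ᴾ s a b with evalPL s a | evalPL s b
... | true | true = refl
... | true | false = refl
... | false | _ = refl

∧ᴾ-true : ∀ s a b → evalPL s (a ∧ᴾ b) ≡ true → evalPL s a ≡ true × evalPL s b ≡ true
∧ᴾ-true s a b h = ∧-true (trans (sym (eval-∧ᴾ s a b)) h)

eval-literal : ∀ s b m → evalPL s (literal b m) ≡ (if b then s m else not (s m))
eval-literal s true m = refl
eval-literal s false m = refl

eval-⊤P : ∀ s → evalPL s ⊤P ≡ true
eval-⊤P s with s 0
... | true = refl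
... | false = refl

eval-⊥P : ∀ s → evalPL s ⊥P ≡ false
eval-⊥P s with s 0
... | true = refl
... | false = refl

eval-support : ∀ s m δ X → evalPL s (support m δ X) ≡ (evalPL s δ ∧ contains X (valuation s m))
eval-support s zero δ true with evalPL s δ
... | true = refl
... | false = refl
eval-support s zero δ false with evalPL s δ
... | true = eval-⊥P s
... | false = eval-⊥P s
eval-support s (suc m) δ (X₀ , X₁)
  rewrite eval-support s m (δ ∧ᴾ literal false m) X₀ | eval-support s m (δ ∧ᴾ literal true m) X₁
        | eval-∧ᴾ s δ (literal false m) | eval-∧ᴾ s δ (literal true m)
  with evalPL s δ | s m
... | true | true = refl
... | true | false = ∨-false (contains X₀ (valuation s m))
  where
    ∨-false : ∀ a → (not (not a) ∨ false) ≡ a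
    ∨-false true = refl
    ∨-false false = refl
... | false | _ = refl

eval-describe : ∀ s m δ p → evalPL s (describe m δ p) ≡ true → (evalPL s δ ≡ true) × (valuation s m ≡ p)
eval-describe s zero δ [] h = h , refl
eval-describe s (suc m) δ (b ∷ p) h with eval-describe s m (δ ∧ᴾ literal b m) p h
... | h₁ , h₂ with ∧ᴾ-true s δ (literal b m) h₁
... | hδ , hl = hδ , cong₂ _∷_ (literal-value b (s m) (trans (sym (eval-literal s b m)) hl)) h₂
  where
    literal-value : ∀ b x → (if b then x else not x) ≡ true → x ≡ b
    literal-value true true _ = refl
    literal-value false false _ = refl

eval-absent : ∀ s m δ X → evalPL s (absent m δ X) ≡ true → evalPL s δ ≡ true → contains X (valuation s m) ≡ true
eval-absent s zero δ true h hδ = refl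
eval-absent s zero δ false h hδ = ⊥-elim (false≢true (trans (sym (cong not hδ)) h))
eval-absent s (suc m) δ (X₀ , X₁) h hδ
  with ∧ᴾ-true s (absent m (δ ∧ᴾ literal false m) X₀) (absent m (δ ∧ᴾ literal true m) X₁) h
... | h₀ , h₁ with s m in eq
... | false = eval-absent s m (δ ∧ᴾ literal false m) X₀ h₀
                (trans (eval-∧ᴾ s δ (literal false m)) (cong₂ _∧_ hδ (cong not eq)))
... | true = eval-absent s m (δ ∧ᴾ literal true m) X₁ h₁
               (trans (eval-∧ᴾ s δ (literal true m)) (cong₂ _∧_ hδ eq))

support-disjoint : ∀ s m δ X b → evalPL s (support m (δ ∧ᴾ literal b m) X) ≡ true →
                   evalPL s (δ ∧ᴾ literal (not b) m) ≡ true → ⊥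
support-disjoint s m δ X b h₁ h₂ with ∧-true {evalPL s (δ ∧ᴾ literal b m)} (trans (sym (eval-support s m _ X)) h₁)
... | h₃ , _ = opposite b (s m) (trans (sym (eval-literal s b m)) (proj₂ (∧ᴾ-true s δ (literal b m) h₃)))
                              (trans (sym (eval-literal s (not b) m)) (proj₂ (∧ᴾ-true s δ (literal (not b) m) h₂)))
  where
    opposite : ∀ b x → (if b then x else not x) ≡ true → (if not b then x else not x) ≡ true → ⊥
    opposite true true _ ()
    opposite true false () _
    opposite false true () _
    opposite false false _ ()

χ-support : ∀ m δ X → ∅ ⊢ (χ m δ X ↣ pl (support m δ X))
χ-support zero δ true = ⊓-fst (pl δ) (∼ pl (neg δ))
χ-support zero δ false = id↣ empty
χ-support (suc m) δ (X₀ , X₁) = ⊗-mono (χ-support m _ X₀) (χ-support m _ X₁) ⟫ flat-join _ _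

χ-realises : ∀ m δ X p → contains X p ≡ true → ∅ ⊢ (χ m δ X ↣ ∼ pl (neg (describe m δ p)))
χ-realises zero δ true [] h = ⊓-snd (pl δ) (∼ pl (neg δ))
χ-realises (suc m) δ (X₀ , X₁) (false ∷ p) h = ⊗-monoˡ _ (χ-realises m _ X₀ p h) ⟫ witness-⊗ _ _
χ-realises (suc m) δ (X₀ , X₁) (true ∷ p) h =
  ⊗-comm _ _ ⟫ ⊗-monoˡ _ (χ-realises m _ X₁ p h) ⟫ witness-⊗ _ _

leaf-join : ∀ δ a b → ∅ ⊢ ((χ zero δ a ⊗ χ zero δ b) ↣ χ zero δ (a ∨ b))
leaf-join δ true true =
  ⊓-pair (⊗-mono (⊓-fst _ _) (⊓-fst _ _) ⟫ flat-join δ δ ⟫ pl-mp (tautPL ((~ x0 ⇛ x0) ⇛ x0) (δ ∷ [])))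
         (⊗-monoˡ (inhabited δ) (⊓-snd _ _) ⟫ witness-⊗ (neg δ) (inhabited δ))
leaf-join δ true false =
  ⊓-pair (⊗-mono (⊓-fst _ _) (id↣ empty) ⟫ flat-join δ ⊥P
            ⟫ pl-mp (tautPL ((~ x0 ⇛ ~ (x1 ⇛ x1)) ⇛ x0) (δ ∷ var 0 ∷ [])))
         (⊗-monoˡ empty (⊓-snd _ _) ⟫ witness-⊗ (neg δ) empty)
leaf-join δ false true = ⊗-comm empty (inhabited δ) ⟫ leaf-join δ true false
leaf-join δ false false =
  flat-join ⊥P ⊥P ⟫ pl-mp (tautPL ((~ ~ (x0 ⇛ x0) ⇛ ~ (x0 ⇛ x0)) ⇛ ~ (x0 ⇛ x0)) (var 0 ∷ []))

leaf-split : ∀ δ a b → ∅ ⊢ (χ zero δ (a ∨ b) ↣ (χ zero δ a ⊗ χ zero δ b))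
leaf-split δ true true =
  MP (id↣ (inhabited δ)) (MP (⊗-intro (inhabited δ) (inhabited δ)) (L2 _ _ (inhabited δ ⊗ inhabited δ)))
leaf-split δ false true =
  combine (⊓-fst _ _ ⟫ pl-mp (tautPL (x0 ⇛ (~ ~ (x1 ⇛ x1) ⇛ x0)) (δ ∷ var 0 ∷ [])) ⟫ flat-split ⊥P δ)
          (⊓-snd _ _)
          (flip↣ (⊗-carry {A = empty} {E = ∼ pl (neg δ)} (pl δ)
            (persists-witness {β = ⊥P} (id↣ empty) (pl-mp (tautPL (~ (x1 ⇛ x1) ⇛ ~ x0) (δ ∷ var 0 ∷ []))))))
leaf-split δ true false = leaf-split δ false true ⟫ ⊗-comm empty (inhabited δ)
leaf-split δ false false =
  pl-mp (tautPL (~ (x0 ⇛ x0) ⇛ (~ ~ (x0 ⇛ x0) ⇛ ~ (x0 ⇛ x0))) (var 0 ∷ [])) ⟫ flat-split ⊥P ⊥P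

χ-join : ∀ m δ Y Z → ∅ ⊢ ((χ m δ Y ⊗ χ m δ Z) ↣ χ m δ (Y ∪ᵛ Z))
χ-join zero δ a b = leaf-join δ a b
χ-join (suc m) δ (Y₀ , Y₁) (Z₀ , Z₁) = ⊗-medial _ _ _ _ ⟫ ⊗-mono (χ-join m _ Y₀ Z₀) (χ-join m _ Y₁ Z₁)

χ-split : ∀ m δ Y Z → ∅ ⊢ (χ m δ (Y ∪ᵛ Z) ↣ (χ m δ Y ⊗ χ m δ Z))
χ-split zero δ a b = leaf-split δ a b
χ-split (suc m) δ (Y₀ , Y₁) (Z₀ , Z₁) = ⊗-mono (χ-split m _ Y₀ Z₀) (χ-split m _ Y₁ Z₁) ⟫ ⊗-medial _ _ _ _

occupied-persists : ∀ m δ X {A β} → ∅ ⊢ (A ↣ pl β) → (∀ s → evalPL s β ≡ true → evalPL s δ ≡ true → ⊥) →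
                    Persists A (occupied m δ X)
occupied-persists zero δ true {β = β} d h =
  persists-witness d (pl-entails β (neg δ) (λ s hb → refute (evalPL s δ) (h s hb)))
  where
    refute : ∀ x → (x ≡ true → ⊥) → not x ≡ true
    refute false _ = refl
    refute true f = ⊥-elim (f refl)
occupied-persists zero δ false d h = persists-⊤
occupied-persists (suc m) δ (X₀ , X₁) d h =
  persists-⊓ (occupied-persists m _ X₀ d (λ s hb hd → h s hb (proj₁ (∧ᴾ-true s δ (literal false m) hd))))
             (occupied-persists m _ X₁ d (λ s hb hd → h s hb (proj₁ (∧ᴾ-true s δ (literal true m) hd))))

χ-build : ∀ m δ X → ∅ ⊢ (pl (support m δ X) ↣ (occupied m δ X ↣ χ m δ X))
χ-build zero δ true = tautL (x0 ⇛ (x1 ⇛ (x0 ∧ₛ x1))) (pl δ ∷ ∼ pl (neg δ) ∷ [])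
χ-build zero δ false = tautL (x0 ⇛ (x1 ⇛ x0)) (empty ∷ pl ⊤P ∷ [])
χ-build (suc m) δ (X₀ , X₁) = curry (carried ⟫ ⊗-mono (uncurry (χ-build m δ₁ X₁)) (uncurry (χ-build m δ₀ X₀))
                                             ⟫ ⊗-comm _ _)
  where
    δ₀ = δ ∧ᴾ literal false m
    δ₁ = δ ∧ᴾ literal true m
    g₀ = support m δ₀ X₀
    g₁ = support m δ₁ X₁
    o₀ = occupied m δ₀ X₀
    o₁ = occupied m δ₁ X₁
    H = pl (g₀ ∨ᶜ g₁) ⊓ (o₀ ⊓ o₁)
    -- split the support flatly, then carry each half's occupancy into its part
    carried₁ : ∅ ⊢ (H ↣ (pl g₀ ⊗ (pl g₁ ⊓ o₁)))
    carried₁ = combine (⊓-snd _ _ ⟫ ⊓-snd _ _) (⊓-fst _ _ ⟫ flat-split g₀ g₁)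
                 (⊗-carry (pl g₁) (occupied-persists m δ₁ X₁ (id↣ (pl g₀))
                   (λ s h₁ h₂ → support-disjoint s m δ X₀ false h₁ h₂)))
    carried : ∅ ⊢ (H ↣ ((pl g₁ ⊓ o₁) ⊗ (pl g₀ ⊓ o₀)))
    carried = combine (⊓-snd _ _ ⟫ ⊓-fst _ _) (carried₁ ⟫ ⊗-comm _ _)
                (⊗-carry (pl g₀) (occupied-persists m δ₀ X₀ (⊓-fst (pl g₁) o₁)
                  (λ s h₁ h₂ → support-disjoint s m δ X₁ true h₁ h₂)))

leafwise-occupied : ∀ m δ X → ∅ ⊢ (leafwise m δ X ↣ occupied m δ X)
leafwise-occupied zero δ true = id↣ _
leafwise-occupied zero δ false = const↣ ⊤-intro
leafwise-occupied (suc m) δ (X₀ , X₁) = ⊓-mono (leafwise-occupied m _ X₀) (leafwise-occupied m _ X₁)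

leafwise-absent : ∀ m δ X → ∅ ⊢ (leafwise m δ X ↣ pl (absent m δ X))
leafwise-absent zero δ true = const↣ ⊤-intro
leafwise-absent zero δ false = id↣ _
leafwise-absent (suc m) δ (X₀ , X₁) = ⊓-mono (leafwise-absent m _ X₀) (leafwise-absent m _ X₁) ⟫
  uncurry (pl-mp₂ (tautPL (x0 ⇛ (x1 ⇛ (x0 ∧ₛ x1)))
    (absent m (δ ∧ᴾ literal false m) X₀ ∷ absent m (δ ∧ᴾ literal true m) X₁ ∷ [])))

absent-support : ∀ m δ X → ∅ ⊢ (pl δ ↣ (pl (absent m δ X) ↣ pl (support m δ X)))
absent-support m δ X = pl-entails₂ δ (absent m δ X) (support m δ X) λ s hδ ha →
  trans (eval-support s m δ X) (cong₂ _∧_ hδ (eval-absent s m δ X ha hδ))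

leafwise-χ : ∀ m X → ∅ ⊢ (leafwise m ⊤P X ↣ χ m ⊤P X)
leafwise-χ m X =
  combine (combine (const↣ ⊤-intro) (leafwise-absent m ⊤P X) (absent-support m ⊤P X))
          (leafwise-occupied m ⊤P X) (χ-build m ⊤P X)

-- Distinct VSets have contradictory characteristic formulas: a valuation in
-- W but not in X is realised under χ W and excluded by the support of X.
support-excludes : ∀ m δ X p → contains X p ≡ false → ∅ ⊢ (pl (support m δ X) ↣ pl (neg (describe m δ p)))
support-excludes m δ X p hp = pl-entails _ _ λ s hg → excluded s hg (evalPL s (describe m δ p)) refl
  where
    excluded : ∀ s → evalPL s (support m δ X) ≡ true → ∀ x → evalPL s (describe m δ p) ≡ x → not x ≡ true
    excluded s hg false _ = refl
    excluded s hg true hx with eval-describe s m δ p hx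
    ... | _ , refl = ⊥-elim (false≢true (trans (sym hp)
                       (proj₂ (∧-true {evalPL s δ} (trans (sym (eval-support s m δ X)) hg)))))

χ-differ : ∀ m δ W X p → contains W p ≡ true → contains X p ≡ false → ∅ ⊢ (χ m δ W ↣ ∼ χ m δ X)
χ-differ m δ W X p hw hx = χ-realises m δ W p hw ⟫ contrap (χ-support m δ X ⟫ support-excludes m δ X p hx)

χ-distinct : ∀ m δ X W → X ≢ W → ∅ ⊢ (χ m δ W ↣ ∼ χ m δ X)
χ-distinct m δ X W ne with vset-differ X W ne
... | p , d with contains X p in ex | contains W p in ew
... | false | true = χ-differ m δ W X p ew ex
... | true | false = contrap′ (χ-differ m δ X W p ex ew)
... | false | false = ⊥-elim (d refl)
... | true | true = ⊥-elim (d refl)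

-- A context F that is antitone and admits case
-- distinction on any formula p is provable at C as soon as it is provable
-- at each leafwise description conjoined with C; the leafwise descriptions
-- are thus provably exhaustive.
record CaseContext (Φ : FmlSet) : Set₁ where
  field
    F : Fml → Fml
    antitone : ∀ {A B} → ∅ ⊢ (A ↣ B) → Φ ⊢ (F B ↣ F A)
    cases : ∀ C p → Φ ⊢ (F (C ⊓ p) ↣ (F (C ⊓ (∼ p)) ↣ F C))

module _ {Φ : FmlSet} (ctx : CaseContext Φ) where
  open CaseContext ctx

  exhaust : ∀ m δ C H → (∀ X → Φ ⊢ (H ↣ F (leafwise m δ X ⊓ C))) → Φ ⊢ (H ↣ F C)
  exhaust zero δ C H h =
    combine (h false ⟫ antitone (tautL ((x0 ∧ₛ x1) ⇛ (x1 ∧ₛ x0)) (C ∷ pl (neg δ) ∷ [])))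
            (h true ⟫ antitone (tautL ((x0 ∧ₛ x1) ⇛ (x1 ∧ₛ x0)) (C ∷ ∼ pl (neg δ) ∷ [])))
            (cases C (pl (neg δ)))
  exhaust (suc m) δ C H h = exhaust m (δ ∧ᴾ literal false m) C H λ X₀ →
    exhaust m (δ ∧ᴾ literal true m) (leafwise m (δ ∧ᴾ literal false m) X₀ ⊓ C) H λ X₁ →
      h (X₀ , X₁) ⟫ antitone (tautL ((x1 ∧ₛ (x0 ∧ₛ x2)) ⇛ ((x0 ∧ₛ x1) ∧ₛ x2))
         (leafwise m (δ ∧ᴾ literal false m) X₀ ∷ leafwise m (δ ∧ᴾ literal true m) X₁ ∷ C ∷ []))

implies-context : ∀ {Φ} G → CaseContext Φ
implies-context G = record
  { F = λ C → C ↣ G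
  ; antitone = λ {A} {B} d → MP (theorem⊢ d) (tautL ((x0 ⇛ x1) ⇛ ((x1 ⇛ x2) ⇛ (x0 ⇛ x2))) (A ∷ B ∷ G ∷ []))
  ; cases = λ C p → tautL (((x0 ∧ₛ x1) ⇛ x2) ⇛ (((x0 ∧ₛ ~ x1) ⇛ x2) ⇛ (x0 ⇛ x2))) (C ∷ p ∷ G ∷ [])
  }

⊸-left-context : ∀ {Φ} ψ → CaseContext Φ
⊸-left-context ψ = record
  { F = λ C → C ⊸ ψ
  ; antitone = λ d → ⊸-antitone ψ d
  ; cases = λ C p → ⊸-cases C p ψ
  }

⊸-right-context : ∀ {Φ} A ψ → CaseContext Φ
⊸-right-context A ψ = record
  { F = λ C → A ⊸ (C ↣ ψ)
  ; antitone = λ {A'} {B} d → ⊸-map A (MP d (tautL ((x0 ⇛ x1) ⇛ ((x1 ⇛ x2) ⇛ (x0 ⇛ x2))) (A' ∷ B ∷ ψ ∷ [])))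
  ; cases = λ C p → ⊸-map₂ A (tautL (((x0 ∧ₛ x1) ⇛ x2) ⇛ (((x0 ∧ₛ ~ x1) ⇛ x2) ⇛ (x0 ⇛ x2))) (C ∷ p ∷ ψ ∷ []))
  }

⊸-by-parts : ∀ {Φ} M H φ ψ → (∀ Y → Φ ⊢ (H ↣ ((χ M ⊤P Y ⊓ φ) ⊸ ψ))) → Φ ⊢ (H ↣ (φ ⊸ ψ))
⊸-by-parts M H φ ψ h =
  exhaust (⊸-left-context ψ) M ⊤P φ H λ Y → h Y ⟫ ⊸-antitone ψ (⊓-mono (leafwise-χ M Y) (id↣ φ))

⊸-by-unions : ∀ {Φ} M H A ψ → (∀ Z → Φ ⊢ (H ↣ (A ⊸ (χ M ⊤P Z ↣ ψ)))) → Φ ⊢ (H ↣ (A ⊸ ψ))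
⊸-by-unions M H A ψ h =
  exhaust (⊸-right-context A ψ) M ⊤P (pl ⊤P) H (λ Z → h Z ⟫ ⊸-map A (weaken-antecedent Z))
  ⟫ ⊸-map A (MP ⊤-intro (tautL (x0 ⇛ ((x0 ⇛ x1) ⇛ x1)) (pl ⊤P ∷ ψ ∷ [])))
  where
    weaken-antecedent : ∀ Z → ∅ ⊢ ((χ M ⊤P Z ↣ ψ) ↣ ((leafwise M ⊤P Z ⊓ pl ⊤P) ↣ ψ))
    weaken-antecedent Z = MP (leafwise-χ M Z) (tautL ((x0 ⇛ x1) ⇛ ((x1 ⇛ x2) ⇛ ((x0 ∧ₛ x3) ⇛ x2)))
                                (leafwise M ⊤P Z ∷ χ M ⊤P Z ∷ ψ ∷ pl ⊤P ∷ []))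

⊸-non-union : ∀ M X Y Z ψ → X ≢ Y ∪ᵛ Z → ∅ ⊢ (χ M ⊤P X ↣ (χ M ⊤P Y ⊸ (χ M ⊤P Z ↣ ψ)))
⊸-non-union M X Y Z ψ ne =
  contrap′ (χ-join M ⊤P Y Z ⟫ χ-distinct M ⊤P X (Y ∪ᵛ Z) ne) ⟫ dne _
  ⟫ ⊸-map (χ M ⊤P Y) (tautL (~ x0 ⇛ (x0 ⇛ x1)) (χ M ⊤P Z ∷ ψ ∷ []))

Projects : Team → (m : ℕ) → VSet m → Set
Projects T m X = ∀ p → (contains X p ≡ true → ∃ λ s → T s × valuation s m ≡ p)
                     × ((∃ λ s → T s × valuation s m ≡ p) → contains X p ≡ true)

valuation-agree : ∀ (s t : Assignment) m → valuation s m ≡ valuation t m → ∀ i → i < m → s i ≡ t i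
valuation-agree s t (suc m) eq i (s≤s le) with i ≟ m
... | yes refl = proj₁ (∷-injective eq)
... | no ne = valuation-agree s t m (proj₂ (∷-injective eq)) i (≤∧≢⇒< le ne)

valuation-cong : ∀ (s t : Assignment) m → (∀ i → i < m → s i ≡ t i) → valuation s m ≡ valuation t m
valuation-cong s t zero h = refl
valuation-cong s t (suc m) h = cong₂ _∷_ (h m ≤-refl) (valuation-cong s t m (λ i lt → h i (m≤n⇒m≤1+n lt)))

assignmentFrom : ∀ {m} → Vec Bool m → Assignment
assignmentFrom [] i = false
assignmentFrom {suc m} (b ∷ p) i with i ≟ m
... | yes _ = b
... | no _ = assignmentFrom p i

valuation-assignmentFrom : ∀ {m} (p : Vec Bool m) → valuation (assignmentFrom p) m ≡ p
valuation-assignmentFrom [] = refl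
valuation-assignmentFrom {suc m} (b ∷ p) =
  cong₂ _∷_ top (trans (valuation-cong _ _ m below) (valuation-assignmentFrom p))
  where
    top : assignmentFrom (b ∷ p) m ≡ b
    top with m ≟ m
    ... | yes _ = refl
    ... | no n = ⊥-elim (n refl)
    below : ∀ i → i < m → assignmentFrom (b ∷ p) i ≡ assignmentFrom p i
    below i lt with i ≟ m
    ... | yes refl = ⊥-elim (<-irrefl refl lt)
    ... | no _ = refl

canonical : (m : ℕ) → VSet m → Team
canonical m X s = contains X (valuation s m) ≡ true

projects-canonical : ∀ m X → Projects (canonical m X) m X
projects-canonical m X p =
  (λ h → assignmentFrom p , subst (λ q → contains X q ≡ true) (sym (valuation-assignmentFrom p)) h
                          , valuation-assignmentFrom p)
  , λ { (s , hs , refl) → hs }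

slice : Team → ℕ → Bool → Team
slice T m b = T ↾ (λ s → s m) ≔ b

branch : ∀ {m} → Bool → VSet (suc m) → VSet m
branch false = proj₁
branch true = proj₂

contains-branch : ∀ {m} b (X : VSet (suc m)) p → contains (branch b X) p ≡ contains X (b ∷ p)
contains-branch false X p = refl
contains-branch true X p = refl

projects-slice : ∀ T m X b → Projects T (suc m) X → Projects (slice T m b) m (branch b X)
projects-slice T m X b h p = down , up
  where
    branch-contains : contains (branch b X) p ≡ contains X (b ∷ p)
    branch-contains = contains-branch b X p
    down : contains (branch b X) p ≡ true → ∃ λ s → slice T m b s × valuation s m ≡ p
    down q with proj₁ (h (b ∷ p)) (trans (sym branch-contains) q)
    ... | s , hs , eq = s , (hs , proj₁ (∷-injective eq)) , proj₂ (∷-injective eq)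
    up : (∃ λ s → slice T m b s × valuation s m ≡ p) → contains (branch b X) p ≡ true
    up (s , (hs , hb) , eq) = trans branch-contains (proj₂ (h (b ∷ p)) (s , hs , cong₂ _∷_ hb eq))

projects-node : ∀ T m X₀ X₁ → Projects (slice T m false) m X₀ → Projects (slice T m true) m X₁ →
                Projects T (suc m) (X₀ , X₁)
projects-node T m X₀ X₁ h₀ h₁ (b ∷ p) = down , up
  where
    slices : ∀ b → Projects (slice T m b) m (branch b (X₀ , X₁))
    slices false = h₀
    slices true = h₁
    hb : Projects (slice T m b) m (branch b (X₀ , X₁))
    hb = slices b
    down : contains (X₀ , X₁) (b ∷ p) ≡ true → ∃ λ s → T s × valuation s (suc m) ≡ b ∷ p
    down q with proj₁ (hb p) (trans (contains-branch b (X₀ , X₁) p) q)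
    ... | s , (hs , eb) , eq = s , hs , cong₂ _∷_ eb eq
    up : (∃ λ s → T s × valuation s (suc m) ≡ b ∷ p) → contains (X₀ , X₁) (b ∷ p) ≡ true
    up (s , hs , eq) = trans (sym (contains-branch b (X₀ , X₁) p))
                             (proj₂ (hb p) (s , (hs , proj₁ (∷-injective eq)) , proj₂ (∷-injective eq)))

∨-true : ∀ {a b : Bool} → (a ∨ b) ≡ true → a ≡ true ⊎ b ≡ true
∨-true {true} _ = inj₁ refl
∨-true {false} h = inj₂ h

bool-ext : ∀ {a b : Bool} → (a ≡ true → b ≡ true) → (b ≡ true → a ≡ true) → a ≡ b
bool-ext {true} {true} f g = refl
bool-ext {true} {false} f g = sym (f refl)
bool-ext {false} {true} f g = g refl
bool-ext {false} {false} f g = refl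

projects-union : ∀ {T S U m X Y Z} → Projects T m X → Projects S m Y → Projects U m Z → IsUnion T S U →
                 X ≡ Y ∪ᵛ Z
projects-union {T} {S} {U} {m} {X} {Y} {Z} hX hY hZ un =
  vset-ext X (Y ∪ᵛ Z) λ p → trans (bool-ext (down p) (up p)) (sym (contains-∪ᵛ Y Z p))
  where
    down : ∀ p → contains X p ≡ true → (contains Y p ∨ contains Z p) ≡ true
    down p q with proj₁ (hX p) q
    ... | s , hs , eq with proj₁ (un s) hs
    ... | inj₁ sS rewrite proj₂ (hY p) (s , sS , eq) = refl
    ... | inj₂ sU rewrite proj₂ (hZ p) (s , sU , eq) with contains Y p
    ...   | true = refl
    ...   | false = refl
    up : ∀ p → (contains Y p ∨ contains Z p) ≡ true → contains X p ≡ true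
    up p q with ∨-true {contains Y p} q
    ... | inj₁ qy with proj₁ (hY p) qy
    ...   | s , hs , eq = proj₂ (hX p) (s , proj₂ (un s) (inj₁ hs) , eq)
    up p q | inj₂ qz with proj₁ (hZ p) qz
    ...   | s , hs , eq = proj₂ (hX p) (s , proj₂ (un s) (inj₂ hs) , eq)

part : Team → (M : ℕ) → VSet M → Team
part T M W = T ↾ (λ s → contains W (valuation s M)) ≔ true

projects-part : ∀ {T M X} W → Projects T M X → (∀ p → contains W p ≡ true → contains X p ≡ true) →
                Projects (part T M W) M W
projects-part W hX incl p =
  (λ q → let (s , hs , e) = proj₁ (hX p) (incl p q)
         in s , (hs , subst (λ r → contains W r ≡ true) (sym e) q) , e)
  , λ { (s , (hs , q) , e) → subst (λ r → contains W r ≡ true) e q }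

split-along : ∀ {T M} Y Z → Projects T M (Y ∪ᵛ Z) →
              IsUnion T (part T M Y) (part T M Z) × Projects (part T M Y) M Y × Projects (part T M Z) M Z
split-along {T} {M} Y Z hX = union , projects-part Y hX inY , projects-part Z hX inZ
  where
    union : IsUnion T (part T M Y) (part T M Z)
    union s = cover , [ proj₁ , proj₁ ]′
      where
        cover : T s → part T M Y s ⊎ part T M Z s
        cover hs with ∨-true {contains Y (valuation s M)}
                        (trans (sym (contains-∪ᵛ Y Z (valuation s M)))
                               (proj₂ (hX (valuation s M)) (s , hs , refl)))
        ... | inj₁ q = inj₁ (hs , q)
        ... | inj₂ q = inj₂ (hs , q)
    inY : ∀ p → contains Y p ≡ true → contains (Y ∪ᵛ Z) p ≡ true
    inY p q rewrite contains-∪ᵛ Y Z p | q = refl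
    inZ : ∀ p → contains Z p ≡ true → contains (Y ∪ᵛ Z) p ≡ true
    inZ p q rewrite contains-∪ᵛ Y Z p | q with contains Y p
    ... | true = refl
    ... | false = refl

module CharacteristicSemantics (lem : ∀ {ℓ} → ExcludedMiddle ℓ) where
  open Semantics lem

  χ-holds : ∀ m δ X T → (∀ s → T s → evalPL s δ ≡ true) → Projects T m X → T ⊨ χ m δ X
  χ-holds zero δ true T hδ hX = ⊨⊓-intro {φ = pl δ} {∼ pl (neg δ)} (lift hδ) λ { (lift f) → no-member f }
    where
      no-member : (∀ s → T s → evalPL s (neg δ) ≡ true) → ⊥
      no-member f with proj₁ (hX []) refl
      ... | s , hs , _ = false≢true (trans (sym (cong not (hδ s hs))) (f s hs))
  χ-holds zero δ false T hδ hX = lift λ s hs → ⊥-elim (false≢true (proj₂ (hX []) (s , hs , refl)))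
  χ-holds (suc m) δ (X₀ , X₁) T hδ hX split-fails =
    split-fails (slice T m false) (slice T m true) (↾-split T (λ s → s m))
      (χ-holds m _ X₀ _
        (λ s hs → trans (eval-∧ᴾ s δ (literal false m)) (cong₂ _∧_ (hδ s (proj₁ hs)) (cong not (proj₂ hs))))
        (projects-slice T m (X₀ , X₁) false hX))
      (χ-holds m _ X₁ _
        (λ s hs → trans (eval-∧ᴾ s δ (literal true m)) (cong₂ _∧_ (hδ s (proj₁ hs)) (proj₂ hs)))
        (projects-slice T m (X₀ , X₁) true hX))

  χ-holds⊤ : ∀ {T m X} → Projects T m X → T ⊨ χ m ⊤P X
  χ-holds⊤ {T} {m} {X} = χ-holds m ⊤P X T (λ s _ → eval-⊤P s)

  forces : ∀ {T m X A} → Projects T m X → ∅ ⊢ (χ m ⊤P X ↣ A) → T ⊨ A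
  forces {T} {A = A} hX d = ⊨↣-elim {ψ = A} (valid d T) (χ-holds⊤ hX)

  χ-determines : ∀ {T m X W} → T ⊨ χ m ⊤P X → T ⊨ χ m ⊤P W → X ≡ W
  χ-determines {T} {m} {X} {W} hX hW with X ≟ᵛ W
  ... | yes eq = eq
  ... | no ne = ⊥-elim (⊨↣-elim {ψ = ∼ χ m ⊤P X} (valid (χ-distinct m ⊤P X W ne) T) hW hX)

  -- Every team has a projection (excluded middle decides each leaf).
  projection : ∀ T m → Σ (VSet m) (Projects T m)
  projection T zero with lem {P = ∃ λ s → T s}
  ... | yes (s , hs) = true , λ { [] → (λ _ → s , hs , refl) , (λ _ → refl) }
  ... | no n = false , λ { [] → (λ ()) , (λ { (s , hs , _) → ⊥-elim (n (s , hs)) }) }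
  projection T (suc m) with projection (slice T m false) m | projection (slice T m true) m
  ... | X₀ , h₀ | X₁ , h₁ = (X₀ , X₁) , projects-node T m X₀ X₁ h₀ h₁

Below : ℕ → Fml → Set
Below M (pl α) = BelowPL M α
Below M (∼ φ) = Below M φ
Below M (φ ↣ ψ) = Below M φ × Below M ψ
Below M (φ ⊸ ψ) = Below M φ × Below M ψ

below-mono : ∀ {M M'} φ → M ≤ M' → Below M φ → Below M' φ
below-mono (pl α) le b = belowPL-mono α le b
below-mono (∼ φ) le b = below-mono φ le b
below-mono (φ ↣ ψ) le (b , c) = below-mono φ le b , below-mono ψ le c
below-mono (φ ⊸ ψ) le (b , c) = below-mono φ le b , below-mono ψ le c

bound : Fml → ℕ
bound (pl α) = boundPL α
bound (∼ φ) = bound φ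
bound (φ ↣ ψ) = bound φ ⊔ bound ψ
bound (φ ⊸ ψ) = bound φ ⊔ bound ψ

bound-below : ∀ φ → Below (bound φ) φ
bound-below (pl α) = boundPL-below α
bound-below (∼ φ) = bound-below φ
bound-below (φ ↣ ψ) = below-mono φ (m≤m⊔n _ _) (bound-below φ) , below-mono ψ (m≤n⊔m _ _) (bound-below ψ)
bound-below (φ ⊸ ψ) = below-mono φ (m≤m⊔n _ _) (bound-below φ) , below-mono ψ (m≤n⊔m _ _) (bound-below ψ)

below-χ : ∀ N m δ X → BelowPL N δ → m ≤ N → 0 < N → Below N (χ m δ X)
below-χ N zero δ true bδ le pos = bδ , bδ
below-χ N zero δ false bδ le pos = pos , pos
below-χ N (suc m) δ (X₀ , X₁) bδ le pos =
  below-χ N m _ X₀ (bδ , le) (<⇒≤ le) pos , below-χ N m _ X₁ (bδ , le) (<⇒≤ le) pos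

refuted-by-description : ∀ M α t → BelowPL M α → evalPL t α ≡ false →
                         ∅ ⊢ (pl α ↣ pl (neg (describe M ⊤P (valuation t M))))
refuted-by-description M α t b ft =
  pl-entails α _ λ s hs → refute s hs (evalPL s (describe M ⊤P (valuation t M))) refl
  where
    refute : ∀ s → evalPL s α ≡ true → ∀ x → evalPL s (describe M ⊤P (valuation t M)) ≡ x → not x ≡ true
    refute s hs false _ = refl
    refute s hs true eq with eval-describe s M ⊤P (valuation t M) eq
    ... | _ , same = ⊥-elim (false≢true (trans (sym ft)
                       (trans (agreePL α t s b (valuation-agree t s M (sym same))) hs)))

module TruthLemma (lem : ∀ {ℓ} → ExcludedMiddle ℓ) where
  open Semantics lem
  open CharacteristicSemantics lem

  Decided : (M : ℕ) → Fml → Team → VSet M → Set₁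
  Decided M φ T X = (T ⊨ φ → ∅ ⊢ (χ M ⊤P X ↣ φ)) × (¬ (T ⊨ φ) → ∅ ⊢ (χ M ⊤P X ↣ ∼ φ))

  Decides : ℕ → Fml → Set₁
  Decides M φ = ∀ T X → Projects T M X → Decided M φ T X

  decides-pl : ∀ M α → BelowPL M α → Decides M (pl α)
  decides-pl M α b T X hX = holds , fails
    where
      -- every support valuation is that of a member, which satisfies α
      holds : T ⊨ pl α → ∅ ⊢ (χ M ⊤P X ↣ pl α)
      holds (lift f) = χ-support M ⊤P X ⟫ pl-entails (support M ⊤P X) α λ s hg →
        let inX = proj₂ (∧-true {evalPL s ⊤P} (trans (sym (eval-support s M ⊤P X)) hg))
            (t , ht , eq) = proj₁ (hX (valuation s M)) inX
        in trans (agreePL α s t b (λ i lt → sym (valuation-agree t s M eq i lt))) (f t ht)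
      -- a member violating α has its valuation realised under χ
      fails : ¬ (T ⊨ pl α) → ∅ ⊢ (χ M ⊤P X ↣ ∼ pl α)
      fails ¬holds with lem {P = ∃ λ t → T t × evalPL t α ≡ false}
      ... | yes (t , ht , ft) = χ-realises M ⊤P X (valuation t M) (proj₂ (hX _) (t , ht , refl))
                                ⟫ contrap (refuted-by-description M α t b ft)
      ... | no none = ⊥-elim (¬holds (lift λ t ht → not-false (evalPL t α) (λ ft → none (t , ht , ft))))
        where
          not-false : ∀ x → ¬ (x ≡ false) → x ≡ true
          not-false true _ = refl
          not-false false ne = ⊥-elim (ne refl)

  decides-∼ : ∀ {M φ} → Decides M φ → Decides M (∼ φ)
  decides-∼ {φ = φ} dφ T X hX = proj₂ (dφ T X hX) , λ ¬¬φ → proj₁ (dφ T X hX) (⊨-stable ¬¬φ) ⟫ dni φ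

  decides-↣ : ∀ {M φ ψ} → Decides M φ → Decides M ψ → Decides M (φ ↣ ψ)
  decides-↣ {φ = φ} {ψ} dφ dψ T X hX = holds , fails
    where
      holds : T ⊨ (φ ↣ ψ) → ∅ ⊢ (χ _ ⊤P X ↣ (φ ↣ ψ))
      holds (inj₁ ¬φ) = proj₂ (dφ T X hX) ¬φ ⟫ tautL (~ x0 ⇛ (x0 ⇛ x1)) (φ ∷ ψ ∷ [])
      holds (inj₂ ψ′) = proj₁ (dψ T X hX) ψ′ ⟫ tautL (x1 ⇛ (x0 ⇛ x1)) (φ ∷ ψ ∷ [])
      fails : ¬ (T ⊨ (φ ↣ ψ)) → ∅ ⊢ (χ _ ⊤P X ↣ ∼ (φ ↣ ψ))
      fails n = combine (proj₁ (dφ T X hX) (⊨-stable (λ ¬φ → n (inj₁ ¬φ))))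
                        (proj₂ (dψ T X hX) (λ ψ′ → n (inj₂ ψ′)))
                  (tautL (x0 ⇛ (~ x1 ⇛ ~ (x0 ⇛ x1))) (φ ∷ ψ ∷ []))

  -- T ⊨ φ ⊸ ψ is proved from χ X part by part: a φ-part with projection Y
  -- that is not a φ-team is impossible; otherwise the complementary part
  -- with projection Z either cannot occur (X ≠ Y ∪ Z) or is a ψ-team,
  -- because T itself splits into parts projecting to Y and Z.
  ⊸-holds : ∀ {M φ ψ T X} → Decides M φ → Decides M ψ → Projects T M X → T ⊨ (φ ⊸ ψ) →
            ∅ ⊢ (χ M ⊤P X ↣ (φ ⊸ ψ))
  ⊸-holds {M} {φ} {ψ} {T} {X} dφ dψ hX h = ⊸-by-parts M (χ M ⊤P X) φ ψ by-part
    where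
      by-part : ∀ Y → ∅ ⊢ (χ M ⊤P X ↣ ((χ M ⊤P Y ⊓ φ) ⊸ ψ))
      by-part Y with lem {P = canonical M Y ⊨ φ}
      ... | no ¬φY = const↣ (⊸-vacuous ψ (MP (proj₂ (dφ _ Y (projects-canonical M Y)) ¬φY)
                        (tautL ((x0 ⇛ ~ x1) ⇛ ~ (x0 ∧ₛ x1)) (χ M ⊤P Y ∷ φ ∷ []))))
      ... | yes φY = ⊸-by-unions M (χ M ⊤P X) (χ M ⊤P Y) ψ by-union ⟫ ⊸-antitone ψ (⊓-fst (χ M ⊤P Y) φ)
        where
          by-union : ∀ Z → ∅ ⊢ (χ M ⊤P X ↣ (χ M ⊤P Y ⊸ (χ M ⊤P Z ↣ ψ)))
          by-union Z with X ≟ᵛ (Y ∪ᵛ Z)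
          ... | no ne = ⊸-non-union M X Y Z ψ ne
          ... | yes refl with split-along Y Z hX
          ...   | un , hS , hU =
                  const↣ (Nec (χ M ⊤P Y) (proj₁ (dψ _ Z hU)
                    (h _ _ un (forces hS (proj₁ (dφ _ Y (projects-canonical M Y)) φY)))))

  -- A failing split S ∪ U of T projects to Y ∪ Z = X, and χ X ↣ χ Y ⊗ χ Z.
  ⊸-fails : ∀ {M φ ψ T X} → Decides M φ → Decides M ψ → Projects T M X → ¬ (T ⊨ (φ ⊸ ψ)) →
            ∅ ⊢ (χ M ⊤P X ↣ ∼ (φ ⊸ ψ))
  ⊸-fails {M} {φ} {ψ} {T} {X} dφ dψ hX ¬h
    with lem {P = Σ Team λ S → Σ Team λ U → IsUnion T S U × S ⊨ φ × ¬ (U ⊨ ψ)}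
  ... | no none = ⊥-elim (¬h λ S U un hS → ⊨-stable λ ¬hU → none (S , U , un , hS , ¬hU))
  ... | yes (S , U , un , hS , ¬hU) with projection S M | projection U M
  ...   | Y , hY | Z , hZ rewrite projects-union hX hY hZ un =
          χ-split M ⊤P Y Z ⟫ ⊗-mono (proj₁ (dφ S Y hY) hS) (proj₂ (dψ U Z hZ) ¬hU) ⟫ contrap (⊸-map φ (dni ψ))

  truth : ∀ M φ → Below M φ → Decides M φ
  truth M (pl α) b = decides-pl M α b
  truth M (∼ φ) b = decides-∼ (truth M φ b)
  truth M (φ ↣ ψ) (bφ , bψ) = decides-↣ (truth M φ bφ) (truth M ψ bψ)
  truth M (φ ⊸ ψ) (bφ , bψ) T X hX =
    (⊸-holds (truth M φ bφ) (truth M ψ bψ) hX) , (⊸-fails (truth M φ bφ) (truth M ψ bψ) hX)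

-- A coherent sequence of projections (each Xₘ is the projection of the
-- canonical team of Xₘ₊₁) is the sequence of projections of one team, the
-- set of assignments all of whose valuations lie in the Xₘ.
module Limit (X : (m : ℕ) → VSet m) (coherent : ∀ m → Projects (canonical (suc m) (X (suc m))) m (X m)) where

  limit : Team
  limit s = ∀ m → contains (X m) (valuation s m) ≡ true

  shrink : ∀ m b p → contains (X (suc m)) (b ∷ p) ≡ true → contains (X m) p ≡ true
  shrink m b p h = proj₂ (coherent m p)
    ( assignmentFrom (b ∷ p)
    , subst (λ q → contains (X (suc m)) q ≡ true) (sym (valuation-assignmentFrom (b ∷ p))) h
    , proj₂ (∷-injective (valuation-assignmentFrom (b ∷ p))))

  shrink* : ∀ s j k → contains (X (j + k)) (valuation s (j + k)) ≡ true → contains (X k) (valuation s k) ≡ true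
  shrink* s zero k h = h
  shrink* s (suc j) k h = shrink* s j k (shrink (j + k) (s (j + k)) (valuation s (j + k)) h)

  grow : ∀ m p → contains (X m) p ≡ true → Σ Bool λ b → contains (X (suc m)) (b ∷ p) ≡ true
  grow m p h with proj₁ (coherent m p) h
  ... | s , hs , refl = s m , hs

  -- Growing a member p of Xₘ forever yields a point of the limit above p.
  module _ (m : ℕ) (p : Vec Bool m) (h : contains (X m) p ≡ true) where
    path : (n : ℕ) → Σ (Vec Bool (n + m)) (λ q → contains (X (n + m)) q ≡ true)
    bit : ℕ → Bool

    bit n = proj₁ (grow (n + m) (proj₁ (path n)) (proj₂ (path n)))
    path zero = p , h
    path (suc n) = (bit n ∷ proj₁ (path n)) , proj₂ (grow (n + m) (proj₁ (path n)) (proj₂ (path n)))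

    point : Assignment
    point i with i <? m
    ... | yes _ = assignmentFrom p i
    ... | no _ = bit (i ∸ m)

    point-low : ∀ i → i < m → point i ≡ assignmentFrom p i
    point-low i lt with i <? m
    ... | yes _ = refl
    ... | no nlt = ⊥-elim (nlt lt)

    point-high : ∀ n → point (n + m) ≡ bit n
    point-high n with (n + m) <? m
    ... | yes lt = ⊥-elim (≤⇒≯ (m≤n+m m n) lt)
    ... | no _ = cong bit (m+n∸n≡m n m)

    point-path : ∀ n → valuation point (n + m) ≡ proj₁ (path n)
    point-path zero = trans (valuation-cong point (assignmentFrom p) m point-low) (valuation-assignmentFrom p)
    point-path (suc n) = cong₂ _∷_ (point-high n) (point-path n)

    point-limit : limit point
    point-limit k = shrink* point m k (subst (λ j → contains (X j) (valuation point j) ≡ true) (+-comm k m)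
                      (subst (λ q → contains (X (k + m)) q ≡ true) (sym (point-path k)) (proj₂ (path k))))

  projects-limit : ∀ m → Projects limit m (X m)
  projects-limit m p = (λ h → point m p h , point-limit m p h , point-path m p h zero)
                     , λ { (s , hs , refl) → hs m }

module Completeness (lem : ∀ {ℓ} → ExcludedMiddle ℓ) where
  open Semantics lem
  open CharacteristicSemantics lem
  open TruthLemma lem

  Consistent : FmlSet → Set₁
  Consistent Δ = ¬ (Δ ⊢ ⊥F)

  clash : ∀ {Δ A C} → Δ C → Δ A → ∅ ⊢ (C ↣ ∼ A) → Δ ⊢ ⊥F
  clash {A = A} hC hA d = MP (MP (hyp hC) (theorem⊢ d)) (MP (hyp hA) (tautL (x0 ⇛ (~ x0 ⇛ x1)) (A ∷ ⊥F ∷ [])))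

  -- Since the leafwise descriptions are exhaustive, some χ m X can be added
  -- consistently.
  extend : (Δ : FmlSet) → Consistent Δ → (m : ℕ) → Σ (VSet m) (λ X → Consistent (Δ ,, χ m ⊤P X))
  extend Δ c m with lem {P = Σ (VSet m) λ X → Consistent (Δ ,, χ m ⊤P X)}
  ... | yes r = r
  ... | no n = ⊥-elim (c (MP ⊤-intro (MP ⊤-intro
                (exhaust (implies-context ⊥F) m ⊤P (pl ⊤P) (pl ⊤P) λ X →
                  const↣ (⊓-fst _ _ ⟫ theorem⊢ (leafwise-χ m X) ⟫ deduction-theorem (inconsistent X))))))
    where
      inconsistent : ∀ X → (Δ ,, χ m ⊤P X) ⊢ ⊥F
      inconsistent X with lem {P = (Δ ,, χ m ⊤P X) ⊢ ⊥F}
      ... | yes d = d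
      ... | no nd = ⊥-elim (n (X , nd))

  module _ (Φ : FmlSet) (φ : Fml) (unprovable : ¬ (Φ ⊢ φ)) where
    Δ₀ : FmlSet
    Δ₀ = Φ ,, (∼ φ)

    consistent₀ : Consistent Δ₀
    consistent₀ d =
      unprovable (MP ⊤-intro (MP (deduction-theorem d) (tautL ((~ x0 ⇛ ~ x1) ⇛ (x1 ⇛ x0)) (φ ∷ pl ⊤P ∷ []))))

    stage : ℕ → Σ FmlSet Consistent
    stage zero = Δ₀ , consistent₀
    stage (suc m) = (proj₁ (stage m) ,, χ m ⊤P (proj₁ (extend (proj₁ (stage m)) (proj₂ (stage m)) m)))
                    , proj₂ (extend (proj₁ (stage m)) (proj₂ (stage m)) m)

    Xs : (m : ℕ) → VSet m
    Xs m = proj₁ (extend (proj₁ (stage m)) (proj₂ (stage m)) m)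

    stage-⊇ : ∀ m ψ → Δ₀ ψ → proj₁ (stage m) ψ
    stage-⊇ zero ψ h = h
    stage-⊇ (suc m) ψ h = inj₁ (stage-⊇ m ψ h)

    -- The canonical team of Xₘ₊₁ satisfies χ m Xₘ (otherwise χ (m+1) Xₘ₊₁
    -- refutes it by the truth lemma), so its projection is Xₘ.
    coherent : ∀ m → Projects (canonical (suc m) (Xs (suc m))) m (Xs m)
    coherent m with projection (canonical (suc m) (Xs (suc m))) m
    ... | X′ , hX′ = subst (Projects _ m) (χ-determines (χ-holds⊤ hX′) satisfies) hX′
      where
        χₘ-below : Below (suc m) (χ m ⊤P (Xs m))
        χₘ-below = below-χ (suc m) m ⊤P (Xs m) (s≤s z≤n , s≤s z≤n) (m≤n⇒m≤1+n ≤-refl) (s≤s z≤n)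
        satisfies : canonical (suc m) (Xs (suc m)) ⊨ χ m ⊤P (Xs m)
        satisfies = ⊨-stable λ fails → proj₂ (stage (suc (suc m)))
          (clash (inj₂ refl) (inj₁ (inj₂ refl))
            (proj₂ (truth (suc m) (χ m ⊤P (Xs m)) χₘ-below _ (Xs (suc m)) (projects-canonical (suc m) (Xs (suc m))))
                   fails))

    open Limit Xs coherent

    -- The limit satisfies every formula ψ of Δ₀: otherwise χ M X_M, for M
    -- bounding the variables of ψ, refutes ψ by the truth lemma.
    limit-satisfies : ∀ ψ → Δ₀ ψ → limit ⊨ ψ
    limit-satisfies ψ hψ = ⊨-stable λ fails → proj₂ (stage (suc M))
      (clash (inj₂ refl) (inj₁ (stage-⊇ M ψ hψ))
        (proj₂ (truth M ψ (bound-below ψ) limit (Xs M) (projects-limit M)) fails))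
      where M = bound ψ

    countermodel : ¬ (Φ ⊫ φ)
    countermodel sem = limit-satisfies (∼ φ) (inj₂ refl) (sem limit (λ ψ hψ → limit-satisfies ψ (inj₁ hψ)))

  complete : ∀ Φ φ → Φ ⊫ φ → Φ ⊢ φ
  complete Φ φ sem with lem {P = Φ ⊢ φ}
  ... | yes d = d
  ... | no nd = ⊥-elim (countermodel Φ φ nd sem)

theorem43 : (lem : ∀ {ℓ} → ExcludedMiddle ℓ) →
    (Φ : FmlSet) (φ : Fml) → (Φ ⊢ φ → Φ ⊫ φ) × (Φ ⊫ φ → Φ ⊢ φ)
theorem43 lem Φ φ = Semantics.sound lem , Completeness.complete lem Φ φ
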